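{- Let $k\ge 2$. For all $j\geq0$, \[ F_{k,k-1+j}(x)=x^{k-1+j}+\sum_{i=0}^{j-1}x^{j+1-i}G_{k,k-1+i}(x)+(k-1)x\,G_{k,k-1+j}(x), \] where $F_{k,\ell}(x)=\sum_{n\ge0}\#\mathcal{P}_{k,\ell}(n)x^n$ and $G_{k,\ell}(x)=\sum_{i\ge\ell}F_{k,i}(x)$.
   Context: A set partition of $[n]=\{1,\dots,n\}$ is identified with its canonical sequential form $\pi_1\cdots\pi_n$: list blocks in increasing order of their minima and set $\pi_i=m$ iff $i$ lies in the $m$-th block. A partition avoids a word $\tau$ if no subsequence of $\pi$ has the same reduced form (relabeling the distinct letters order-preservingly by $1,2,\dots$) as $\tau$. $\mathcal{P}_k(n)$ is the set of partitions of $[n]$ avoiding $12\cdots k12$. A partition $\pi$ of $[n]$ is $\ell$-increasing if $n\ge \ell$, $\pi_i=i$ for $i=1,\dots,\ell$, and (when $n>\ell$) $\pi_{\ell+1}\neq \ell+1$. $\mathcal{P}_{k,\ell}(n)$ is the set of $\ell$-increasing partitions in $\mathcal{P}_k(n)$. -}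

module Defs where

open import Data.Nat using (ℕ; zero; suc; _+_; _*_; _∸_; _<ᵇ_; _≡ᵇ_; _≤ᵇ_; _⊔_)
open import Data.Bool using (Bool; true; false; _∧_; _∨_; not; if_then_else_)
open import Data.List using (List; []; _∷_; _++_; map; concatMap; length; take; drop; foldr; upTo; filterᵇ)
open import Data.Bool.ListAction using (any)
open import Data.Nat.ListAction using (sum)

-- Words over ℕ (letters are positive integers in the paper's convention)

_=ʷ_ : List ℕ → List ℕ → Bool
[] =ʷ [] = true
(x ∷ xs) =ʷ (y ∷ ys) = (x ≡ᵇ y) ∧ (xs =ʷ ys)
_ =ʷ _ = false

oneTo : ℕ → List ℕ
oneTo m = map suc (upTo m)

maxW : List ℕ → ℕ
maxW = foldr _⊔_ 0

-- Set partitions of [n] in canonical sequential form (restricted growth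
-- words): π₁ = 1 and π_{i+1} ≤ 1 + max(π₁…π_i).  Generated left to right.
partitions : ℕ → List (List ℕ)
partitions zero = [] ∷ []
partitions (suc n) =
  concatMap (λ w → map (λ v → w ++ (v ∷ [])) (oneTo (suc (maxW w)))) (partitions n)

subseqs : List ℕ → List (List ℕ)
subseqs [] = [] ∷ []
subseqs (x ∷ xs) = map (x ∷_) (subseqs xs) ++ subseqs xs

memb : ℕ → List ℕ → Bool
memb x = any (x ≡ᵇ_)

dedup : List ℕ → List ℕ
dedup [] = []
dedup (x ∷ xs) = if memb x xs then dedup xs else x ∷ dedup xs

reduce : List ℕ → List ℕ
reduce w = map (λ x → suc (length (dedup (filterᵇ (_<ᵇ x) w)))) w

contains : List ℕ → List ℕ → Bool
contains π τ = any (λ s → reduce s =ʷ reduce τ) (subseqs π)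

avoids : List ℕ → List ℕ → Bool
avoids π τ = not (contains π τ)

pat : ℕ → List ℕ
pat k = oneTo k ++ (1 ∷ 2 ∷ [])

-- ℓ-increasing: n ≥ ℓ, π_i = i for i ≤ ℓ, and (if n > ℓ) π_{ℓ+1} ≠ ℓ+1
nextOK : ℕ → List ℕ → Bool
nextOK ℓ [] = true
nextOK ℓ (x ∷ _) = not (x ≡ᵇ suc ℓ)

increasing : ℕ → List ℕ → Bool
increasing ℓ π = (ℓ ≤ᵇ length π) ∧ (take ℓ π =ʷ oneTo ℓ) ∧ nextOK ℓ (drop ℓ π)

countP : ℕ → ℕ → ℕ → ℕ
countP k ℓ n = length (filterᵇ (λ π → increasing ℓ π ∧ avoids π (pat k)) (partitions n))

FPS : Set
FPS = ℕ → ℕ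

_⊕_ : FPS → FPS → FPS
(f ⊕ g) n = f n + g n
infixl 6 _⊕_

scale : ℕ → FPS → FPS
scale c f n = c * f n

mono : ℕ → FPS
mono a n = if a ≡ᵇ n then 1 else 0

shift : ℕ → FPS → FPS
shift a f n = if a ≤ᵇ n then f (n ∸ a) else 0

sumS : ℕ → (ℕ → FPS) → FPS
sumS j h n = sum (map (λ i → h i n) (upTo j))

F : ℕ → ℕ → FPS
F k ℓ n = countP k ℓ n

-- The coefficient of x^n is
-- Σ_{i ≥ ℓ} #P_{k,i}(n); since ℓ-increasing partitions of [n] require n ≥ ℓ,
-- the terms with i > n vanish by definition, so we sum i = ℓ, …, n.
G : ℕ → ℕ → FPS
G k ℓ n = sum (map (λ t → F k (ℓ + t) n) (upTo (suc n ∸ ℓ)))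

-- Write k = K + 2. In a restricted growth word every value up to the running maximum has already
-- occurred, in increasing order of first occurrences. Hence the word contains 1 2 ⋯ k 1 2 iff it has
-- letters a < b, in this order, such that the prefix before a already reached b + K. A left-to-right
-- scan decides this by keeping the running maximum and the set of forbidden letters (those whose next
-- occurrence would play the role of b).
-- After 1 2 ⋯ ℓ nothing is forbidden, and the avoiding continuations of length s are counted by the
-- coefficient of x^(ℓ+s) in G_{k,ℓ}. An ℓ-increasing partition, ℓ = k − 1 + j, continues with a letter
-- v ≤ ℓ. If v > j, nothing becomes forbidden and the scan is back in its state after 1 ⋯ ℓ: this gives
-- (k − 1) x G_{k,ℓ}. If v = i + 1 ≤ j, the letters i + 2, …, j + 1 become forbidden for good; deleting
-- them turns the scan into its state after 1 ⋯ (k − 1 + i), which gives x^(j+1−i) G_{k,k−1+i}.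
-- Finally x^ℓ counts the partition 1 ⋯ ℓ itself.

module Submission where

open import Defs
open import Data.Nat using (ℕ; zero; suc; _+_; _*_; _∸_; _<ᵇ_; _≡ᵇ_; _≤ᵇ_; _⊔_; _≤_; _<_; z≤n; s≤s)
open import Data.Nat.Properties
open import Algebra.Properties.CommutativeSemigroup +-commutativeSemigroup using (xy∙z≈xz∙y; xy∙z≈x∙zy)
open import Data.Bool using (Bool; true; false; _∧_; _∨_; not)
open import Data.Empty using (⊥-elim)
open import Data.Bool.Properties using (T-≡; ∧-zeroʳ)
open import Function.Bundles using (Equivalence)
open import Data.List using (List; []; _∷_; _++_; foldl; initLast; _∷ʳ′_; map; concatMap; length; take; drop; upTo; applyUpTo; filterᵇ)
open import Data.List.Properties
  using (foldl-∷ʳ; filter-++; map-id; ++-assoc; ++-identityʳ; map-++; map-∘; map-cong; map-cong-local; ∷ʳ-injective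
        ; length-++; length-map; ∷-injectiveˡ; ∷-injectiveʳ; concatMap-++; concatMap-pure)
open import Data.List.Relation.Unary.All as All using (All; []; _∷_)
open import Data.List.Relation.Unary.AllPairs using (AllPairs; []; _∷_)
open import Data.List.Relation.Unary.Any using (here; there)
open import Data.List.Relation.Unary.Any.Properties using (any⁺; any⁻)
open import Data.List.Membership.Propositional using (_∈_; find; lose)
open import Data.List.Membership.Propositional.Properties
  using (∈-++⁺ˡ; ∈-++⁺ʳ; ∈-++⁻; ∈-map⁺; ∈-map⁻; ∈-filter⁺; ∈-filter⁻; ∈-concatMap⁻; ∈-upTo⁻)
open import Data.List.Relation.Binary.Sublist.Propositional {A = ℕ} using (_⊆_; []; _∷_; _∷ʳ_; minimum)
open import Data.List.Relation.Binary.Sublist.Propositional.Properties using (++⁺; ++⁺ˡ; Any-resp-⊆)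
open import Data.Nat.ListAction using (sum)
open import Data.Nat.ListAction.Properties using (sum-++)
open import Data.Product using (Σ; ∃-syntax; _×_; _,_; proj₁; proj₂)
open import Data.Sum using (_⊎_; inj₁; inj₂; [_,_]′)
open import Data.Unit using (⊤; tt)
open import Relation.Nullary using (¬_; yes; no)
open import Relation.Nullary.Decidable using (T?)
open import Relation.Nullary.Reflects using (Reflects; ofʸ; ofⁿ; fromEquivalence; det; ¬-reflects; _×-reflects_; _⊎-reflects_)
open import Function using (case_of_)
open import Relation.Binary.Definitions using (tri<; tri≈; tri>)
open import Relation.Binary.PropositionalEquality

≡true-if : ∀ {P : Set} {b} → Reflects P b → P → b ≡ true
≡true-if (ofʸ _) _ = refl
≡true-if (ofⁿ ¬p) p = ⊥-elim (¬p p)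

≡false-if : ∀ {P : Set} {b} → Reflects P b → ¬ P → b ≡ false
≡false-if (ofʸ p) ¬p = ⊥-elim (¬p p)
≡false-if (ofⁿ _) _ = refl

holds-if-≡true : ∀ {P : Set} {b} → Reflects P b → b ≡ true → P
holds-if-≡true (ofʸ p) _ = p

≡-if-⇔ : ∀ {P Q : Set} {a b} → Reflects P a → Reflects Q b → (P → Q) → (Q → P) → a ≡ b
≡-if-⇔ (ofʸ p) rq p⇒q _ = sym (≡true-if rq (p⇒q p))
≡-if-⇔ (ofⁿ ¬p) rq _ q⇒p = sym (≡false-if rq (λ q → ¬p (q⇒p q)))

reflects-if : ∀ {P : Set} {b} → (b ≡ true → P) → (P → b ≡ true) → Reflects P b
reflects-if {b = true} ⇒P _ = ofʸ (⇒P refl)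
reflects-if {b = false} _ P⇒ = ofⁿ λ p → case P⇒ p of λ ()

Reflects-map : ∀ {P Q : Set} {b} → (P → Q) → (Q → P) → Reflects P b → Reflects Q b
Reflects-map P⇒Q _ (ofʸ p) = ofʸ (P⇒Q p)
Reflects-map _ Q⇒P (ofⁿ ¬p) = ofⁿ λ q → ¬p (Q⇒P q)

≡ᵇ-reflects-≡ : ∀ m n → Reflects (m ≡ n) (m ≡ᵇ n)
≡ᵇ-reflects-≡ m n = fromEquivalence (≡ᵇ⇒≡ m n) (≡⇒≡ᵇ m n)


interval : ℕ → ℕ → List ℕ
interval a zero = []
interval a (suc n) = a ∷ interval (suc a) n

map-suc-interval : ∀ a n → map suc (interval a n) ≡ interval (suc a) n
map-suc-interval a zero = refl
map-suc-interval a (suc n) = cong (suc a ∷_) (map-suc-interval (suc a) n)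

map-+-interval : ∀ d a n → map (_+ d) (interval a n) ≡ interval (a + d) n
map-+-interval d a zero = refl
map-+-interval d a (suc n) = cong (a + d ∷_) (map-+-interval d (suc a) n)

upTo≡interval : ∀ n → upTo n ≡ interval 0 n
upTo≡interval n = trans (applyUpTo≡map n (λ x → x)) (map-id (interval 0 n))
  where
  applyUpTo≡map : ∀ n (f : ℕ → ℕ) → applyUpTo f n ≡ map f (interval 0 n)
  applyUpTo≡map zero f = refl
  applyUpTo≡map (suc n) f = cong (f 0 ∷_) (begin
    applyUpTo (λ x → f (suc x)) n          ≡⟨ applyUpTo≡map n (λ x → f (suc x)) ⟩
    map (λ x → f (suc x)) (interval 0 n)   ≡⟨ map-∘ (interval 0 n) ⟩
    map f (map suc (interval 0 n))         ≡⟨ cong (map f) (map-suc-interval 0 n) ⟩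
    map f (interval 1 n)                   ∎)
    where open ≡-Reasoning

oneTo≡interval : ∀ n → oneTo n ≡ interval 1 n
oneTo≡interval n = trans (cong (map suc) (upTo≡interval n)) (map-suc-interval 0 n)

interval-++ : ∀ a m n → interval a (m + n) ≡ interval a m ++ interval (a + m) n
interval-++ a zero n = cong (λ b → interval b n) (sym (+-identityʳ a))
interval-++ a (suc m) n =
  cong (a ∷_) (trans (interval-++ (suc a) m n) (cong (λ b → interval (suc a) m ++ interval b n) (sym (+-suc a m))))

length-interval : ∀ a n → length (interval a n) ≡ n
length-interval a zero = refl
length-interval a (suc n) = cong suc (length-interval (suc a) n)

∈-interval⁻ : ∀ {a n x} → x ∈ interval a n → a ≤ x × x < a + n
∈-interval⁻ {a} {suc n} (here refl) = ≤-refl , m<m+n a (s≤s z≤n)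
∈-interval⁻ {a} {suc n} {x} (there x∈) =
  let a<x , x<1+a+n = ∈-interval⁻ {suc a} {n} x∈ in <⇒≤ a<x , subst (x <_) (sym (+-suc a n)) x<1+a+n

All-interval : ∀ {P : ℕ → Set} a n → (∀ x → a ≤ x → x < a + n → P x) → All P (interval a n)
All-interval a n p = All.tabulate (λ {x} x∈ → let a≤x , x<a+n = ∈-interval⁻ x∈ in p x a≤x x<a+n)

interval-increasing : ∀ a n → AllPairs _<_ (interval a n)
interval-increasing a zero = []
interval-increasing a (suc n) = All-interval (suc a) n (λ _ a<x _ → a<x) ∷ interval-increasing (suc a) n

oneTo-∷ʳ : ∀ ℓ → oneTo (suc ℓ) ≡ oneTo ℓ ++ suc ℓ ∷ []
oneTo-∷ʳ ℓ = begin
  oneTo (suc ℓ)                           ≡⟨ oneTo≡interval (suc ℓ) ⟩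
  interval 1 (suc ℓ)                      ≡⟨ cong (interval 1) (+-comm 1 ℓ) ⟩
  interval 1 (ℓ + 1)                      ≡⟨ interval-++ 1 ℓ 1 ⟩
  interval 1 ℓ ++ suc ℓ ∷ []              ≡⟨ cong (_++ suc ℓ ∷ []) (sym (oneTo≡interval ℓ)) ⟩
  oneTo ℓ ++ suc ℓ ∷ []                   ∎
  where open ≡-Reasoning

oneTo-+ : ∀ a b → oneTo (a + b) ≡ interval 1 a ++ interval (1 + a) b
oneTo-+ a b = trans (oneTo≡interval (a + b)) (interval-++ 1 a b)

length-oneTo : ∀ ℓ → length (oneTo ℓ) ≡ ℓ
length-oneTo ℓ = trans (cong length (oneTo≡interval ℓ)) (length-interval 1 ℓ)

∈-oneTo⁻ : ∀ {ℓ v} → v ∈ oneTo ℓ → 1 ≤ v × v ≤ ℓ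
∈-oneTo⁻ {ℓ} v∈ = let 1≤v , v<1+ℓ = ∈-interval⁻ (subst (_ ∈_) (oneTo≡interval ℓ) v∈) in 1≤v , ≤-pred v<1+ℓ

-- Reduced forms

memb-reflects-∈ : ∀ x s → Reflects (x ∈ s) (memb x s)
memb-reflects-∈ x [] = ofⁿ λ ()
memb-reflects-∈ x (y ∷ s) with x ≡ᵇ y | ≡ᵇ-reflects-≡ x y
... | true | ofʸ refl = ofʸ (here refl)
... | false | ofⁿ x≢y with memb x s | memb-reflects-∈ x s
...   | true | ofʸ x∈s = ofʸ (there x∈s)
...   | false | ofⁿ x∉s = ofⁿ λ { (here x≡y) → x≢y x≡y ; (there x∈s) → x∉s x∈s }

=ʷ-reflects-≡ : ∀ u v → Reflects (u ≡ v) (u =ʷ v)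
=ʷ-reflects-≡ [] [] = ofʸ refl
=ʷ-reflects-≡ [] (_ ∷ _) = ofⁿ λ ()
=ʷ-reflects-≡ (_ ∷ _) [] = ofⁿ λ ()
=ʷ-reflects-≡ (x ∷ u) (y ∷ v) with x ≡ᵇ y | ≡ᵇ-reflects-≡ x y
... | false | ofⁿ x≢y = ofⁿ λ e → x≢y (∷-injectiveˡ e)
... | true | ofʸ refl with u =ʷ v | =ʷ-reflects-≡ u v
...   | true | ofʸ refl = ofʸ refl
...   | false | ofⁿ u≢v = ofⁿ λ e → u≢v (∷-injectiveʳ e)

fromBool : Bool → ℕ
fromBool true = 1
fromBool false = 0

fromBool-+-not : ∀ b → fromBool b + fromBool (not b) ≡ 1
fromBool-+-not true = refl
fromBool-+-not false = refl

below : List ℕ → ℕ → ℕ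
below s zero = 0
below s (suc x) = below s x + fromBool (memb x s)

below-[] : ∀ x → below [] x ≡ 0
below-[] zero = refl
below-[] (suc x) = trans (+-identityʳ (below [] x)) (below-[] x)

below-∷ : ∀ y ys x → below (y ∷ ys) x ≡ below ys x + fromBool ((y <ᵇ x) ∧ not (memb y ys))
below-∷ y ys zero = refl
below-∷ y ys (suc x) = begin
  below (y ∷ ys) x + fromBool (memb x (y ∷ ys))
    ≡⟨ cong (_+ fromBool (memb x (y ∷ ys))) (below-∷ y ys x) ⟩
  below ys x + fromBool ((y <ᵇ x) ∧ not (memb y ys)) + fromBool (memb x (y ∷ ys))
    ≡⟨ +-assoc (below ys x) _ _ ⟩
  below ys x + (fromBool ((y <ᵇ x) ∧ not (memb y ys)) + fromBool (memb x (y ∷ ys)))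
    ≡⟨ cong (below ys x +_) new-letter ⟩
  below ys x + (fromBool (memb x ys) + fromBool ((y <ᵇ suc x) ∧ not (memb y ys)))
    ≡⟨ sym (+-assoc (below ys x) _ _) ⟩
  below ys x + fromBool (memb x ys) + fromBool ((y <ᵇ suc x) ∧ not (memb y ys))
    ∎
  where
  open ≡-Reasoning
  new-letter : fromBool ((y <ᵇ x) ∧ not (memb y ys)) + fromBool (memb x (y ∷ ys))
             ≡ fromBool (memb x ys) + fromBool ((y <ᵇ suc x) ∧ not (memb y ys))
  new-letter with x ≟ y
  ... | yes refl
    rewrite ≡false-if (<ᵇ-reflects-< x x) (<-irrefl refl)
          | ≡true-if (≡ᵇ-reflects-≡ x x) refl
          | ≡true-if (<ᵇ-reflects-< x (suc x)) ≤-refl = sym (fromBool-+-not (memb x ys))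
  ... | no x≢y
    rewrite ≡false-if (≡ᵇ-reflects-≡ x y) x≢y
          | ≡-if-⇔ (<ᵇ-reflects-< y x) (<ᵇ-reflects-< y (suc x)) m<n⇒m<1+n
                   (λ y<1+x → ≤∧≢⇒< (≤-pred y<1+x) (λ y≡x → x≢y (sym y≡x)))
    = +-comm _ (fromBool (memb x ys))

memb-filter-< : ∀ {x y} ys → y < x → memb y (filterᵇ (_<ᵇ x) ys) ≡ memb y ys
memb-filter-< {x} {y} ys y<x =
  ≡-if-⇔ (memb-reflects-∈ y _) (memb-reflects-∈ y ys)
    (λ y∈ → proj₁ (∈-filter⁻ (λ z → T? (z <ᵇ x)) y∈))
    (λ y∈ → ∈-filter⁺ (λ z → T? (z <ᵇ x)) y∈ (<⇒<ᵇ y<x))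

distinct-below≡below : ∀ s x → length (dedup (filterᵇ (_<ᵇ x) s)) ≡ below s x
distinct-below≡below [] x = sym (below-[] x)
distinct-below≡below (y ∷ ys) x rewrite below-∷ y ys x with y <ᵇ x in y<ᵇx
... | false = trans (distinct-below≡below ys x) (sym (+-identityʳ (below ys x)))
... | true rewrite memb-filter-< ys (holds-if-≡true (<ᵇ-reflects-< y x) y<ᵇx) with memb y ys
...   | true = trans (distinct-below≡below ys x) (sym (+-identityʳ (below ys x)))
...   | false = trans (cong suc (distinct-below≡below ys x)) (+-comm 1 (below ys x))

reduce≡map-below : ∀ s → reduce s ≡ map (λ x → suc (below s x)) s
reduce≡map-below s = map-cong (λ x → cong suc (distinct-below≡below s x)) s

below-mono-≤ : ∀ s {x y} → x ≤ y → below s x ≤ below s y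
below-mono-≤ s {x} {zero} z≤n = ≤-refl
below-mono-≤ s {x} {suc y} x≤1+y with m≤n⇒m<n∨m≡n x≤1+y
... | inj₁ x<1+y = ≤-trans (below-mono-≤ s (≤-pred x<1+y)) (m≤m+n (below s y) _)
... | inj₂ refl = ≤-refl

below-mono-< : ∀ s {x y} → x < y → x ∈ s → below s x < below s y
below-mono-< s {x} {y} x<y x∈s = begin-strict
  below s x                        <⟨ m<m+n (below s x) (s≤s z≤n) ⟩
  below s x + 1                    ≡⟨ cong (λ b → below s x + fromBool b) (sym (≡true-if (memb-reflects-∈ x s) x∈s)) ⟩
  below s (suc x)                  ≤⟨ below-mono-≤ s x<y ⟩
  below s y                        ∎
  where open ≤-Reasoning

below-cancel-< : ∀ s {x y} → below s x < below s y → x < y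
below-cancel-< s {x} {y} bx<by = ≰⇒> (λ y≤x → <⇒≱ bx<by (below-mono-≤ s y≤x))

below-injective : ∀ s {x y} → x ∈ s → y ∈ s → below s x ≡ below s y → x ≡ y
below-injective s {x} {y} x∈s y∈s bx≡by with <-cmp x y
... | tri< x<y _ _ = ⊥-elim (<-irrefl bx≡by (below-mono-< s x<y x∈s))
... | tri≈ _ x≡y _ = x≡y
... | tri> _ _ y<x = ⊥-elim (<-irrefl (sym bx≡by) (below-mono-< s y<x y∈s))

below-cong : ∀ s t → (∀ v → memb v s ≡ memb v t) → ∀ x → below s x ≡ below t x
below-cong s t same zero = refl
below-cong s t same (suc x) = cong₂ _+_ (below-cong s t same x) (cong fromBool (same x))

below-minimum : ∀ s x → All (x ≤_) s → below s x ≡ 0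
below-minimum s zero _ = refl
below-minimum s (suc x) 1+x≤s with memb x s | memb-reflects-∈ x s
... | true | ofʸ x∈s = ⊥-elim (<-irrefl refl (All.lookup 1+x≤s x∈s))
... | false | ofⁿ _ = trans (+-identityʳ _) (below-minimum s x (All.map (≤-trans (n≤1+n x)) 1+x≤s))

reduce-increasing : ∀ c → AllPairs _<_ c → map (λ x → suc (below c x)) c ≡ interval 1 (length c)
reduce-increasing [] [] = refl
reduce-increasing (y ∷ ys) (y<ys ∷ ys↑) = cong₂ _∷_ first rest
  where
  y∉ys : memb y ys ≡ false
  y∉ys = ≡false-if (memb-reflects-∈ y ys) (λ y∈ys → <-irrefl refl (All.lookup y<ys y∈ys))
  first : suc (below (y ∷ ys) y) ≡ 1
  first = cong suc (begin
    below (y ∷ ys) y                                ≡⟨ below-∷ y ys y ⟩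
    below ys y + fromBool ((y <ᵇ y) ∧ not (memb y ys))
      ≡⟨ cong (λ b → below ys y + fromBool (b ∧ not (memb y ys))) (≡false-if (<ᵇ-reflects-< y y) (<-irrefl refl)) ⟩
    below ys y + 0                                  ≡⟨ +-identityʳ _ ⟩
    below ys y                                      ≡⟨ below-minimum ys y (All.map <⇒≤ y<ys) ⟩
    0                                               ∎)
    where open ≡-Reasoning
  shifted : ∀ {x} → y < x → suc (below (y ∷ ys) x) ≡ suc (suc (below ys x))
  shifted {x} y<x = cong suc (begin
    below (y ∷ ys) x                                   ≡⟨ below-∷ y ys x ⟩
    below ys x + fromBool ((y <ᵇ x) ∧ not (memb y ys))
      ≡⟨ cong₂ (λ b c → below ys x + fromBool (b ∧ not c)) (≡true-if (<ᵇ-reflects-< y x) y<x) y∉ys ⟩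
    below ys x + 1                                     ≡⟨ +-comm _ 1 ⟩
    suc (below ys x)                                   ∎)
    where open ≡-Reasoning
  rest : map (λ x → suc (below (y ∷ ys) x)) ys ≡ interval 2 (length ys)
  rest = begin
    map (λ x → suc (below (y ∷ ys) x)) ys       ≡⟨ map-cong-local (All.map shifted y<ys) ⟩
    map (λ x → suc (suc (below ys x))) ys       ≡⟨ map-∘ ys ⟩
    map suc (map (λ x → suc (below ys x)) ys)   ≡⟨ cong (map suc) (reduce-increasing ys ys↑) ⟩
    map suc (interval 1 (length ys))            ≡⟨ map-suc-interval 1 (length ys) ⟩
    interval 2 (length ys)                      ∎
    where open ≡-Reasoning

-- Occurrences of 1 2 ⋯ (K + 2) 1 2

data PatternWord (K : ℕ) : List ℕ → Set where
  pattern-word : ∀ {a b cs} → AllPairs _<_ (a ∷ b ∷ cs) → length cs ≡ K →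
                 PatternWord K ((a ∷ b ∷ cs) ++ a ∷ b ∷ [])

pat≡interval : ∀ K → pat (2 + K) ≡ interval 1 (2 + K) ++ 1 ∷ 2 ∷ []
pat≡interval K = cong (_++ 1 ∷ 2 ∷ []) (oneTo≡interval (2 + K))

pat-PatternWord : ∀ K → PatternWord K (pat (2 + K))
pat-PatternWord K =
  subst (PatternWord K) (sym (pat≡interval K)) (pattern-word (interval-increasing 1 (2 + K)) (length-interval 3 K))

PatternWord⇒reduce≡pat : ∀ {K s} → PatternWord K s → reduce s ≡ pat (2 + K)
PatternWord⇒reduce≡pat {K} (pattern-word {a} {b} {cs} c↑ refl) = begin
  reduce (c ++ a ∷ b ∷ [])                                  ≡⟨ reduce≡map-below (c ++ a ∷ b ∷ []) ⟩
  map (λ x → suc (below (c ++ a ∷ b ∷ []) x)) (c ++ a ∷ b ∷ [])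
    ≡⟨ map-cong (λ x → cong suc (below-cong (c ++ a ∷ b ∷ []) c same-letters x)) (c ++ a ∷ b ∷ []) ⟩
  map rank (c ++ a ∷ b ∷ [])                                ≡⟨ map-++ rank c (a ∷ b ∷ []) ⟩
  map rank c ++ rank a ∷ rank b ∷ []                        ≡⟨ cong (λ r → r ++ rank a ∷ rank b ∷ []) rank-c ⟩
  interval 1 (2 + K) ++ rank a ∷ rank b ∷ []
    ≡⟨ cong₂ (λ u v → interval 1 (2 + K) ++ u ∷ v ∷ []) (∷-injectiveˡ rank-c) (∷-injectiveˡ (∷-injectiveʳ rank-c)) ⟩
  interval 1 (2 + K) ++ 1 ∷ 2 ∷ []                          ≡⟨ sym (pat≡interval K) ⟩
  pat (2 + K)                                               ∎
  where
  open ≡-Reasoning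
  c = a ∷ b ∷ cs
  rank : ℕ → ℕ
  rank x = suc (below c x)
  rank-c : map rank c ≡ interval 1 (2 + K)
  rank-c = reduce-increasing c c↑
  same-letters : ∀ v → memb v (c ++ a ∷ b ∷ []) ≡ memb v c
  same-letters v = ≡-if-⇔ (memb-reflects-∈ v _) (memb-reflects-∈ v c) into-c (∈-++⁺ˡ)
    where
    into-c : v ∈ c ++ a ∷ b ∷ [] → v ∈ c
    into-c v∈ with ∈-++⁻ c v∈
    ... | inj₁ v∈c = v∈c
    ... | inj₂ (here refl) = here refl
    ... | inj₂ (there (here refl)) = there (here refl)

map-≡-++⁻ : ∀ {A : Set} (h : ℕ → A) s xs ys → map h s ≡ xs ++ ys →
            ∃[ s₁ ] ∃[ s₂ ] s ≡ s₁ ++ s₂ × map h s₁ ≡ xs × map h s₂ ≡ ys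
map-≡-++⁻ h s [] ys e = [] , s , refl , refl , e
map-≡-++⁻ h (z ∷ s) (x ∷ xs) ys e =
  let s₁ , s₂ , s≡ , e₁ , e₂ = map-≡-++⁻ h s xs ys (∷-injectiveʳ e)
  in z ∷ s₁ , s₂ , cong (z ∷_) s≡ , cong₂ _∷_ (∷-injectiveˡ e) e₁ , e₂

increasing-if-ranks-consecutive : ∀ s c m n → map (λ x → suc (below s x)) c ≡ interval m n → AllPairs _<_ c
increasing-if-ranks-consecutive s [] m n _ = []
increasing-if-ranks-consecutive s (y ∷ ys) m (suc n) e =
  All.tabulate y<z ∷ increasing-if-ranks-consecutive s ys (suc m) n (∷-injectiveʳ e)
  where
  y<z : ∀ {z} → z ∈ ys → y < z
  y<z {z} z∈ys = below-cancel-< s (begin-strict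
    below s y               <⟨ ≤-reflexive (∷-injectiveˡ e) ⟩
    m                       ≤⟨ ≤-pred (proj₁ (∈-interval⁻ (subst (suc (below s z) ∈_) (∷-injectiveʳ e)
                                                     (∈-map⁺ (λ x → suc (below s x)) z∈ys)))) ⟩
    below s z               ∎)
    where open ≤-Reasoning

reduce≡pat⇒PatternWord : ∀ K s → reduce s ≡ pat (2 + K) → PatternWord K s
reduce≡pat⇒PatternWord K s e
  with map-≡-++⁻ (λ x → suc (below s x)) s (interval 1 (2 + K)) (1 ∷ 2 ∷ [])
         (trans (sym (reduce≡map-below s)) (trans e (pat≡interval K)))
... | a ∷ b ∷ cs , a′ ∷ b′ ∷ [] , refl , ranks , ranks′ =
  subst (λ t → PatternWord K ((a ∷ b ∷ cs) ++ t)) (cong₂ (λ u v → u ∷ v ∷ []) a≡a′ b≡b′)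
    (pattern-word (increasing-if-ranks-consecutive s (a ∷ b ∷ cs) 1 (2 + K) ranks)
                  (trans (sym (length-map _ cs)) (trans (cong length (∷-injectiveʳ (∷-injectiveʳ ranks))) (length-interval 3 K))))
  where
  c = a ∷ b ∷ cs
  a≡a′ : a ≡ a′
  a≡a′ = below-injective s (here refl) (∈-++⁺ʳ c (here refl))
           (suc-injective (trans (∷-injectiveˡ ranks) (sym (∷-injectiveˡ ranks′))))
  b≡b′ : b ≡ b′
  b≡b′ = below-injective s (there (here refl)) (∈-++⁺ʳ c (there (here refl)))
           (suc-injective (trans (∷-injectiveˡ (∷-injectiveʳ ranks)) (sym (∷-injectiveˡ (∷-injectiveʳ ranks′)))))

∈-subseqs⁻ : ∀ {s} π → s ∈ subseqs π → s ⊆ π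
∈-subseqs⁻ [] (here refl) = []
∈-subseqs⁻ (x ∷ π) s∈ with ∈-++⁻ (map (x ∷_) (subseqs π)) s∈
... | inj₂ s∈′ = x ∷ʳ ∈-subseqs⁻ π s∈′
... | inj₁ s∈x∷ with ∈-map⁻ (x ∷_) s∈x∷
...   | t , t∈ , refl = refl ∷ ∈-subseqs⁻ π t∈

∈-subseqs⁺ : ∀ {s π} → s ⊆ π → s ∈ subseqs π
∈-subseqs⁺ [] = here refl
∈-subseqs⁺ {π = y ∷ π} (y ∷ʳ s⊆π) = ∈-++⁺ʳ (map (y ∷_) (subseqs π)) (∈-subseqs⁺ s⊆π)
∈-subseqs⁺ (refl ∷ s⊆π) = ∈-++⁺ˡ (∈-map⁺ (_ ∷_) (∈-subseqs⁺ s⊆π))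

reduce-pat : ∀ K → reduce (pat (2 + K)) ≡ pat (2 + K)
reduce-pat K = PatternWord⇒reduce≡pat (pat-PatternWord K)

contains-pat⁻ : ∀ K π → contains π (pat (2 + K)) ≡ true → ∃[ s ] s ⊆ π × PatternWord K s
contains-pat⁻ K π e =
  let s , s∈ , same = find (any⁻ _ (subseqs π) (Equivalence.from T-≡ e))
  in s , ∈-subseqs⁻ π s∈ ,
     reduce≡pat⇒PatternWord K s (trans (holds-if-≡true (=ʷ-reflects-≡ _ _) (Equivalence.to T-≡ same)) (reduce-pat K))

contains-pat⁺ : ∀ K {π s} → s ⊆ π → PatternWord K s → contains π (pat (2 + K)) ≡ true
contains-pat⁺ K {s = s} s⊆π p = Equivalence.to T-≡ (any⁺ _ (lose (∈-subseqs⁺ s⊆π) (Equivalence.from T-≡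
  (≡true-if (=ʷ-reflects-≡ _ _) (trans (PatternWord⇒reduce≡pat p) (sym (reduce-pat K)))))))

-- Occurrences in restricted growth words

∈⇒≤maxW : ∀ {x} π → x ∈ π → x ≤ maxW π
∈⇒≤maxW (y ∷ π) (here refl) = m≤m⊔n y (maxW π)
∈⇒≤maxW (y ∷ π) (there x∈π) = ≤-trans (∈⇒≤maxW π x∈π) (m≤n⊔m y (maxW π))

maxW-++ : ∀ xs ys → maxW (xs ++ ys) ≡ maxW xs ⊔ maxW ys
maxW-++ [] ys = refl
maxW-++ (x ∷ xs) ys = trans (cong (x ⊔_) (maxW-++ xs ys)) (sym (⊔-assoc x (maxW xs) (maxW ys)))

maxW-∷ʳ : ∀ p v → maxW (p ++ v ∷ []) ≡ maxW p ⊔ v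
maxW-∷ʳ p v = trans (maxW-++ p (v ∷ [])) (cong (maxW p ⊔_) (⊔-identityʳ v))

maxW-oneTo : ∀ ℓ → maxW (oneTo ℓ) ≡ ℓ
maxW-oneTo zero = refl
maxW-oneTo (suc ℓ) = begin
  maxW (oneTo (suc ℓ))           ≡⟨ cong maxW (oneTo-∷ʳ ℓ) ⟩
  maxW (oneTo ℓ ++ suc ℓ ∷ [])   ≡⟨ maxW-∷ʳ (oneTo ℓ) (suc ℓ) ⟩
  maxW (oneTo ℓ) ⊔ suc ℓ         ≡⟨ cong (_⊔ suc ℓ) (maxW-oneTo ℓ) ⟩
  ℓ ⊔ suc ℓ                      ≡⟨ m≤n⇒m⊔n≡n (n≤1+n ℓ) ⟩
  suc ℓ                          ∎
  where open ≡-Reasoning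

⊆-++⁻ : ∀ xs ys {π} → xs ++ ys ⊆ π → ∃[ π₁ ] ∃[ π₂ ] π ≡ π₁ ++ π₂ × xs ⊆ π₁ × ys ⊆ π₂
⊆-++⁻ [] ys {π} ys⊆π = [] , π , refl , [] , ys⊆π
⊆-++⁻ (x ∷ xs) ys (y ∷ʳ p) =
  let π₁ , π₂ , e , p₁ , p₂ = ⊆-++⁻ (x ∷ xs) ys p in y ∷ π₁ , π₂ , cong (y ∷_) e , y ∷ʳ p₁ , p₂
⊆-++⁻ (x ∷ xs) ys (refl ∷ p) =
  let π₁ , π₂ , e , p₁ , p₂ = ⊆-++⁻ xs ys p in x ∷ π₁ , π₂ , cong (x ∷_) e , refl ∷ p₁ , p₂

∷-⊆⁻ : ∀ {y ys π} → y ∷ ys ⊆ π → ∃[ π₁ ] ∃[ π₂ ] π ≡ π₁ ++ y ∷ π₂ × ys ⊆ π₂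
∷-⊆⁻ (z ∷ʳ p) = let π₁ , π₂ , e , q = ∷-⊆⁻ p in z ∷ π₁ , π₂ , cong (z ∷_) e , q
∷-⊆⁻ (refl ∷ p) = [] , _ , refl , p

increasing⇒last≥ : ∀ b cs → AllPairs _<_ (b ∷ cs) → ∃[ e ] e ∈ b ∷ cs × b + length cs ≤ e
increasing⇒last≥ b [] _ = b , here refl , ≤-reflexive (+-identityʳ b)
increasing⇒last≥ b (c ∷ cs) ((b<c ∷ _) ∷ c∷cs↑) =
  let e , e∈ , c+|cs|≤e = increasing⇒last≥ c cs c∷cs↑
  in e , there e∈ , ≤-trans (≤-reflexive (+-suc b (length cs))) (≤-trans (+-monoˡ-≤ (length cs) b<c) c+|cs|≤e)

-- The last two letters a < b of an occurrence, after a prefix that already reached b + K.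
Violation : ℕ → List ℕ → Set
Violation K π = ∃[ w₁ ] ∃[ a ] ∃[ w₂ ] ∃[ b ] ∃[ w₃ ] π ≡ w₁ ++ a ∷ w₂ ++ b ∷ w₃ × a < b × b + K ≤ maxW w₁

PatternWord⇒Violation : ∀ {K π s} → s ⊆ π → PatternWord K s → Violation K π
PatternWord⇒Violation {π = π} s⊆π (pattern-word {a} {b} {cs} ((a<b ∷ _) ∷ b∷cs↑) refl) =
  let π₁ , π₂ , π≡π₁π₂ , c⊆π₁ , ab⊆π₂ = ⊆-++⁻ (a ∷ b ∷ cs) (a ∷ b ∷ []) s⊆π
      p₁ , p₂ , π₂≡ , b⊆p₂ = ∷-⊆⁻ ab⊆π₂
      q₁ , q₂ , p₂≡ , _ = ∷-⊆⁻ b⊆p₂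
      e , e∈ , b+K≤e = increasing⇒last≥ b cs b∷cs↑
  in π₁ ++ p₁ , a , q₁ , b , q₂ ,
     trans π≡π₁π₂ (trans (cong (π₁ ++_) (trans π₂≡ (cong (λ u → p₁ ++ a ∷ u) p₂≡))) (sym (++-assoc π₁ p₁ _))) ,
     a<b ,
     ≤-trans b+K≤e (≤-trans (∈⇒≤maxW π₁ (Any-resp-⊆ c⊆π₁ (there e∈)))
                            (≤-trans (m≤m⊔n (maxW π₁) (maxW p₁)) (≤-reflexive (sym (maxW-++ π₁ p₁)))))

-- Words that may follow a prefix with maximum m in the canonical form of a set partition.
RestrictedGrowth : ℕ → List ℕ → Set
RestrictedGrowth m [] = ⊤
RestrictedGrowth m (x ∷ xs) = 1 ≤ x × x ≤ suc m × RestrictedGrowth (m ⊔ x) xs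

RestrictedGrowth-++⁻ˡ : ∀ m xs ys → RestrictedGrowth m (xs ++ ys) → RestrictedGrowth m xs
RestrictedGrowth-++⁻ˡ m [] ys _ = tt
RestrictedGrowth-++⁻ˡ m (x ∷ xs) ys (1≤x , x≤1+m , rg) = 1≤x , x≤1+m , RestrictedGrowth-++⁻ˡ (m ⊔ x) xs ys rg

RestrictedGrowth-positive : ∀ m π {x} → RestrictedGrowth m π → x ∈ π → 1 ≤ x
RestrictedGrowth-positive m (y ∷ π) (1≤y , _ , _) (here refl) = 1≤y
RestrictedGrowth-positive m (y ∷ π) (_ , _ , rg) (there x∈π) = RestrictedGrowth-positive (m ⊔ y) π rg x∈π

first-occurrence : ∀ m u z → RestrictedGrowth m u → m < z → z ≤ m ⊔ maxW u →
  ∃[ u₁ ] ∃[ u₂ ] u ≡ u₁ ++ z ∷ u₂ × RestrictedGrowth z u₂ × m ⊔ maxW u ≤ z ⊔ maxW u₂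
first-occurrence m [] z _ m<z z≤m = ⊥-elim (<⇒≱ m<z (subst (z ≤_) (⊔-identityʳ m) z≤m))
first-occurrence m (x ∷ xs) z (_ , x≤1+m , rg) m<z z≤max with <-cmp x z
... | tri≈ _ refl _ =
  [] , xs , refl , subst (λ n → RestrictedGrowth n xs) m⊔z≡z rg ,
  ≤-reflexive (trans (sym (⊔-assoc m z (maxW xs))) (cong (_⊔ maxW xs) m⊔z≡z))
  where m⊔z≡z = m≤n⇒m⊔n≡n (<⇒≤ m<z)
... | tri> _ _ z<x = ⊥-elim (<⇒≱ z<x (≤-trans x≤1+m m<z))
... | tri< x<z _ _ =
  let u₁ , u₂ , xs≡ , rg₂ , max≤ = first-occurrence (m ⊔ x) xs z rg (⊔-lub m<z x<z)
                                     (subst (z ≤_) (sym (⊔-assoc m x (maxW xs))) z≤max)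
  in x ∷ u₁ , u₂ , cong (x ∷_) xs≡ , rg₂ , ≤-trans (≤-reflexive (sym (⊔-assoc m x (maxW xs)))) max≤

increasing-⊆ : ∀ L m u → RestrictedGrowth m u → AllPairs _<_ L →
               All (λ x → m < x × x ≤ m ⊔ maxW u) L → L ⊆ u
increasing-⊆ [] m u _ _ _ = minimum u
increasing-⊆ (z ∷ L) m u rg (z<L ∷ L↑) ((m<z , z≤max) ∷ L-bounds)
  with first-occurrence m u z rg m<z z≤max
... | u₁ , u₂ , refl , rg₂ , max≤ = ++⁺ˡ u₁ (refl ∷ increasing-⊆ L z u₂ rg₂ L↑ (bounds z<L L-bounds))
  where
  bounds : ∀ {L′} → All (z <_) L′ → All (λ x → m < x × x ≤ m ⊔ maxW (u₁ ++ z ∷ u₂)) L′ →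
           All (λ x → z < x × x ≤ z ⊔ maxW u₂) L′
  bounds [] [] = []
  bounds (z<x ∷ z<L′) ((_ , x≤max) ∷ L′-bounds) = (z<x , ≤-trans x≤max max≤) ∷ bounds z<L′ L′-bounds

Violation⇒PatternWord : ∀ K π → RestrictedGrowth 0 π → Violation K π → ∃[ s ] s ⊆ π × PatternWord K s
Violation⇒PatternWord K π rg (w₁ , a , w₂ , b , w₃ , refl , a<b , b+K≤max) =
  L ++ a ∷ b ∷ [] , ++⁺ L⊆w₁ (refl ∷ ++⁺ˡ w₂ (refl ∷ minimum w₃)) , pattern-word L↑ (length-interval (suc b) K)
  where
  L = a ∷ interval b (suc K)
  L↑ : AllPairs _<_ L
  L↑ = All-interval b (suc K) (λ x b≤x _ → <-≤-trans a<b b≤x) ∷ interval-increasing b (suc K)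
  1≤a : 1 ≤ a
  1≤a = RestrictedGrowth-positive 0 π rg (∈-++⁺ʳ w₁ (here refl))
  L-bounds : All (λ x → 0 < x × x ≤ maxW w₁) L
  L-bounds = (1≤a , ≤-trans (<⇒≤ a<b) (≤-trans (m≤m+n b K) b+K≤max))
           ∷ All-interval b (suc K) (λ x b≤x x<b+1+K →
               ≤-trans 1≤a (≤-trans (<⇒≤ a<b) b≤x) , ≤-trans (≤-pred (subst (x <_) (+-suc b K) x<b+1+K)) b+K≤max)
  L⊆w₁ : L ⊆ w₁
  L⊆w₁ = increasing-⊆ L 0 w₁ (RestrictedGrowth-++⁻ˡ 0 w₁ _ rg) L↑ L-bounds

-- A left-to-right scan deciding avoidance

-- A later letter x would be the b of a violation.
Forbidden : ℕ → List ℕ → ℕ → Set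
Forbidden K p x = ∃[ w₁ ] ∃[ a ] ∃[ w₂ ] p ≡ w₁ ++ a ∷ w₂ × a < x × x + K ≤ maxW w₁

∷ʳ-split : ∀ w₁ (a : ℕ) w₂ p v → w₁ ++ a ∷ w₂ ≡ p ++ v ∷ [] →
           (w₁ ≡ p × a ≡ v) ⊎ Σ (List ℕ) λ w₂′ → p ≡ w₁ ++ a ∷ w₂′
∷ʳ-split w₁ a w₂ p v e with initLast w₂
... | [] = inj₁ (∷ʳ-injective w₁ p e)
... | w₂′ ∷ʳ′ y =
  inj₂ (w₂′ , sym (proj₁ (∷ʳ-injective (w₁ ++ a ∷ w₂′) p (trans (++-assoc w₁ (a ∷ w₂′) (y ∷ [])) e))))

Forbidden-∷ʳ⁻ : ∀ K p v x → Forbidden K (p ++ v ∷ []) x → Forbidden K p x ⊎ (v < x × x + K ≤ maxW p)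
Forbidden-∷ʳ⁻ K p v x (w₁ , a , w₂ , e , a<x , x+K≤max) with ∷ʳ-split w₁ a w₂ p v (sym e)
... | inj₁ (refl , refl) = inj₂ (a<x , x+K≤max)
... | inj₂ (w₂′ , p≡) = inj₁ (w₁ , a , w₂′ , p≡ , a<x , x+K≤max)

Forbidden-∷ʳ⁺ : ∀ K p v x → Forbidden K p x ⊎ (v < x × x + K ≤ maxW p) → Forbidden K (p ++ v ∷ []) x
Forbidden-∷ʳ⁺ K p v x (inj₁ (w₁ , a , w₂ , refl , a<x , x+K≤max)) =
  w₁ , a , w₂ ++ v ∷ [] , ++-assoc w₁ (a ∷ w₂) _ , a<x , x+K≤max
Forbidden-∷ʳ⁺ K p v x (inj₂ (v<x , x+K≤max)) = p , v , [] , refl , v<x , x+K≤max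

Violation-∷ʳ⁻ : ∀ K p v → Violation K (p ++ v ∷ []) → Violation K p ⊎ Forbidden K p v
Violation-∷ʳ⁻ K p v (w₁ , a , w₂ , b , w₃ , e , a<b , b+K≤max)
  with ∷ʳ-split (w₁ ++ a ∷ w₂) b w₃ p v (trans (++-assoc w₁ (a ∷ w₂) (b ∷ w₃)) (sym e))
... | inj₁ (p≡ , refl) = inj₂ (w₁ , a , w₂ , sym p≡ , a<b , b+K≤max)
... | inj₂ (w₃′ , p≡) = inj₁ (w₁ , a , w₂ , b , w₃′ , trans p≡ (++-assoc w₁ (a ∷ w₂) (b ∷ w₃′)) , a<b , b+K≤max)

Violation-∷ʳ⁺ : ∀ K p v → Violation K p ⊎ Forbidden K p v → Violation K (p ++ v ∷ [])
Violation-∷ʳ⁺ K p v (inj₁ (w₁ , a , w₂ , b , w₃ , refl , a<b , b+K≤max)) =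
  w₁ , a , w₂ , b , w₃ ++ v ∷ [] ,
  trans (++-assoc w₁ (a ∷ w₂ ++ b ∷ w₃) _) (cong (λ u → w₁ ++ a ∷ u) (++-assoc w₂ (b ∷ w₃) _)) , a<b , b+K≤max
Violation-∷ʳ⁺ K p v (inj₂ (w₁ , a , w₂ , refl , a<v , v+K≤max)) =
  w₁ , a , w₂ , v , [] , ++-assoc w₁ (a ∷ w₂) _ , a<v , v+K≤max

record State : Set where
  constructor state
  field
    top : ℕ
    forbidden : ℕ → Bool
    alive : Bool
open State

step : ℕ → State → ℕ → State
step K (state m f o) v = state (m ⊔ v) (λ x → f x ∨ ((v <ᵇ x) ∧ (x + K ≤ᵇ m))) (o ∧ not (f v))

run : ℕ → State → List ℕ → State
run K = foldl (step K)

start : State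
start = state 0 (λ _ → false) true

record Tracks (K : ℕ) (p : List ℕ) (σ : State) : Set where
  field
    top≡maxW : top σ ≡ maxW p
    forbidden-reflects : ∀ x → Reflects (Forbidden K p x) (forbidden σ x)
    alive-reflects : Reflects (¬ Violation K p) (alive σ)
open Tracks

Tracks-start : ∀ K → Tracks K [] start
Tracks-start K = record
  { top≡maxW = refl
  ; forbidden-reflects = λ x → ofⁿ λ { ([] , _ , _ , () , _) ; (_ ∷ _ , _ , _ , () , _) }
  ; alive-reflects = ofʸ λ { ([] , _ , _ , _ , _ , () , _) ; (_ ∷ _ , _ , _ , _ , _ , () , _) }
  }

Tracks-step : ∀ {K p σ} v → Tracks K p σ → Tracks K (p ++ v ∷ []) (step K σ v)
Tracks-step {K} {p} {state m f o} v t = record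
  { top≡maxW = trans (cong (_⊔ v) (top≡maxW t)) (sym (maxW-∷ʳ p v))
  ; forbidden-reflects = λ x → Reflects-map (Forbidden-∷ʳ⁺ K p v x) (Forbidden-∷ʳ⁻ K p v x)
      (forbidden-reflects t x ⊎-reflects (<ᵇ-reflects-< v x ×-reflects
        subst (λ n → Reflects (x + K ≤ n) (x + K ≤ᵇ m)) (top≡maxW t) (≤ᵇ-reflects-≤ (x + K) m)))
  ; alive-reflects = Reflects-map
      (λ (¬V , ¬F) V′ → [ ¬V , ¬F ]′ (Violation-∷ʳ⁻ K p v V′))
      (λ ¬V′ → (λ V → ¬V′ (Violation-∷ʳ⁺ K p v (inj₁ V))) , (λ F → ¬V′ (Violation-∷ʳ⁺ K p v (inj₂ F))))
      (alive-reflects t ×-reflects ¬-reflects (forbidden-reflects t v))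
  }

Tracks-run : ∀ {K p σ} q → Tracks K p σ → Tracks K (p ++ q) (run K σ q)
Tracks-run {K} {p} {σ} [] t = subst (λ p′ → Tracks K p′ σ) (sym (++-identityʳ p)) t
Tracks-run {K} {p} {σ} (v ∷ q) t =
  subst (λ p′ → Tracks K p′ (run K (step K σ v) q)) (++-assoc p (v ∷ []) q) (Tracks-run q (Tracks-step v t))

Tracks-run-start : ∀ K p → Tracks K p (run K start p)
Tracks-run-start K p = Tracks-run p (Tracks-start K)

contains-reflects-Violation : ∀ K π → RestrictedGrowth 0 π → Reflects (Violation K π) (contains π (pat (2 + K)))
contains-reflects-Violation K π rg = reflects-if
  (λ c → let s , s⊆π , w = contains-pat⁻ K π c in PatternWord⇒Violation s⊆π w)
  (λ V → let s , s⊆π , w = Violation⇒PatternWord K π rg V in contains-pat⁺ K s⊆π w)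

avoids≡alive : ∀ K π → RestrictedGrowth 0 π → avoids π (pat (2 + K)) ≡ alive (run K start π)
avoids≡alive K π rg = det (¬-reflects (contains-reflects-Violation K π rg)) (alive-reflects (Tracks-run-start K π))

-- Counting avoiding continuations

children : List ℕ → List (List ℕ)
children w = map (λ v → w ++ v ∷ []) (oneTo (suc (maxW w)))

extensions : List ℕ → ℕ → List (List ℕ)
extensions w zero = w ∷ []
extensions w (suc r) = concatMap children (extensions w r)

partitions≡extensions : ∀ n → partitions n ≡ extensions [] n
partitions≡extensions zero = refl
partitions≡extensions (suc n) = cong (concatMap children) (partitions≡extensions n)

concatMap-concatMap : ∀ (f g : List ℕ → List (List ℕ)) xs →
                      concatMap f (concatMap g xs) ≡ concatMap (λ x → concatMap f (g x)) xs
concatMap-concatMap f g [] = refl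
concatMap-concatMap f g (x ∷ xs) =
  trans (concatMap-++ f (g x) (concatMap g xs)) (cong (concatMap f (g x) ++_) (concatMap-concatMap f g xs))

extensions-+ : ∀ w r s → extensions w (r + s) ≡ concatMap (λ u → extensions u s) (extensions w r)
extensions-+ w r zero = trans (cong (extensions w) (+-identityʳ r)) (sym (concatMap-pure (extensions w r)))
extensions-+ w r (suc s) = begin
  extensions w (r + suc s)                                               ≡⟨ cong (extensions w) (+-suc r s) ⟩
  concatMap children (extensions w (r + s))                              ≡⟨ cong (concatMap children) (extensions-+ w r s) ⟩
  concatMap children (concatMap (λ u → extensions u s) (extensions w r)) ≡⟨ concatMap-concatMap children _ (extensions w r) ⟩
  concatMap (λ u → extensions u (suc s)) (extensions w r)                ∎
  where open ≡-Reasoning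

∈-concatMap⁻′ : ∀ (g : List ℕ → List (List ℕ)) {π} xs → π ∈ concatMap g xs → ∃[ x ] x ∈ xs × π ∈ g x
∈-concatMap⁻′ g xs π∈ = find (∈-concatMap⁻ g {xs} π∈)

∈-children⁻ : ∀ {π} w → π ∈ children w → ∃[ v ] 1 ≤ v × v ≤ suc (maxW w) × π ≡ w ++ v ∷ []
∈-children⁻ w π∈ =
  let v , v∈ , π≡ = ∈-map⁻ (λ v → w ++ v ∷ []) π∈ ; 1≤v , v≤ = ∈-oneTo⁻ v∈ in v , 1≤v , v≤ , π≡

∈-extensions⁻ : ∀ w r {π} → π ∈ extensions w r → ∃[ t ] π ≡ w ++ t × length t ≡ r
∈-extensions⁻ w zero (here refl) = [] , sym (++-identityʳ w) , refl
∈-extensions⁻ w (suc r) π∈ with ∈-concatMap⁻′ children (extensions w r) π∈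
... | u , u∈ , π∈u with ∈-extensions⁻ w r u∈ | ∈-children⁻ u π∈u
... | t , refl , |t|≡r | v , _ , _ , refl =
  t ++ v ∷ [] , ++-assoc w t (v ∷ []) , trans (length-++ t) (trans (+-comm (length t) 1) (cong suc |t|≡r))

RestrictedGrowth-∷ʳ : ∀ m u v → RestrictedGrowth m u → 1 ≤ v → v ≤ suc (m ⊔ maxW u) → RestrictedGrowth m (u ++ v ∷ [])
RestrictedGrowth-∷ʳ m [] v _ 1≤v v≤ = 1≤v , subst (λ n → v ≤ suc n) (⊔-identityʳ m) v≤ , tt
RestrictedGrowth-∷ʳ m (x ∷ xs) v (1≤x , x≤ , rg) 1≤v v≤ =
  1≤x , x≤ , RestrictedGrowth-∷ʳ (m ⊔ x) xs v rg 1≤v (subst (λ n → v ≤ suc n) (sym (⊔-assoc m x (maxW xs))) v≤)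

extensions[]⇒RestrictedGrowth : ∀ n {π} → π ∈ extensions [] n → RestrictedGrowth 0 π
extensions[]⇒RestrictedGrowth zero (here refl) = tt
extensions[]⇒RestrictedGrowth (suc n) π∈ with ∈-concatMap⁻′ children (extensions [] n) π∈
... | u , u∈ , π∈u with ∈-children⁻ u π∈u
... | v , 1≤v , v≤ , refl = RestrictedGrowth-∷ʳ 0 u v (extensions[]⇒RestrictedGrowth n u∈) 1≤v v≤

count : (List ℕ → Bool) → List (List ℕ) → ℕ
count P xs = length (filterᵇ P xs)

count-++ : ∀ P xs ys → count P (xs ++ ys) ≡ count P xs + count P ys
count-++ P xs ys = trans (cong length (filter-++ (λ x → T? (P x)) xs ys)) (length-++ (filterᵇ P xs))

count-concatMap : ∀ P (g : List ℕ → List (List ℕ)) xs → count P (concatMap g xs) ≡ sum (map (λ x → count P (g x)) xs)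
count-concatMap P g [] = refl
count-concatMap P g (x ∷ xs) = trans (count-++ P (g x) (concatMap g xs)) (cong (count P (g x) +_) (count-concatMap P g xs))

count-cong : ∀ P Q xs → (∀ {π} → π ∈ xs → P π ≡ Q π) → count P xs ≡ count Q xs
count-cong P Q [] _ = refl
count-cong P Q (x ∷ xs) P≡Q with P x | Q x | P≡Q (here refl)
... | true | .true | refl = cong suc (count-cong P Q xs (λ π∈ → P≡Q (there π∈)))
... | false | .false | refl = count-cong P Q xs (λ π∈ → P≡Q (there π∈))

count-zero : ∀ P xs → (∀ {π} → π ∈ xs → P π ≡ false) → count P xs ≡ 0
count-zero P [] _ = refl
count-zero P (x ∷ xs) P≡false with P x | P≡false (here refl)
... | false | refl = count-zero P xs (λ π∈ → P≡false (there π∈))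

sum-map-++ : ∀ {A : Set} (g : A → ℕ) xs ys → sum (map g (xs ++ ys)) ≡ sum (map g xs) + sum (map g ys)
sum-map-++ g xs ys = trans (cong sum (map-++ g xs ys)) (sum-++ (map g xs) _)

sum-map-cong : ∀ {A : Set} {g h : A → ℕ} {xs} → All (λ v → g v ≡ h v) xs → sum (map g xs) ≡ sum (map h xs)
sum-map-cong g≡h = cong sum (map-cong-local g≡h)

sum-map-zero : ∀ {A : Set} {g : A → ℕ} {xs} → All (λ v → g v ≡ 0) xs → sum (map g xs) ≡ 0
sum-map-zero [] = refl
sum-map-zero (g≡0 ∷ gs≡0) = cong₂ _+_ g≡0 (sum-map-zero gs≡0)

sum-map-const : ∀ {A : Set} {g : A → ℕ} {c} {xs} → All (λ v → g v ≡ c) xs → sum (map g xs) ≡ length xs * c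
sum-map-const [] = refl
sum-map-const (g≡c ∷ gs≡c) = cong₂ _+_ g≡c (sum-map-const gs≡c)

survivors : ℕ → State → ℕ → ℕ
survivors K σ zero = fromBool (alive σ)
survivors K σ (suc s) = sum (map (λ v → survivors K (step K σ v) s) (oneTo (suc (top σ))))

extensions-suc : ∀ w s → extensions w (suc s) ≡ concatMap (λ u → extensions u s) (children w)
extensions-suc w s = trans (extensions-+ w 1 s) (cong (concatMap (λ u → extensions u s)) (++-identityʳ (children w)))

count-extensions-suc : ∀ P w s →
  count P (extensions w (suc s)) ≡ sum (map (λ v → count P (extensions (w ++ v ∷ []) s)) (oneTo (suc (maxW w))))
count-extensions-suc P w s = begin
  count P (extensions w (suc s))                            ≡⟨ cong (count P) (extensions-suc w s) ⟩
  count P (concatMap (λ u → extensions u s) (children w))   ≡⟨ count-concatMap P (λ u → extensions u s) (children w) ⟩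
  sum (map (λ u → count P (extensions u s)) (children w))   ≡⟨ cong sum (map-∘ (oneTo (suc (maxW w)))) ⟨
  sum (map (λ v → count P (extensions (w ++ v ∷ []) s)) (oneTo (suc (maxW w)))) ∎
  where open ≡-Reasoning

count-alive-extensions : ∀ K w s → count (λ π → alive (run K start π)) (extensions w s) ≡ survivors K (run K start w) s
count-alive-extensions K w zero with alive (run K start w)
... | true = refl
... | false = refl
count-alive-extensions K w (suc s) = begin
  count P (extensions w (suc s))
    ≡⟨ count-extensions-suc P w s ⟩
  sum (map (λ v → count P (extensions (w ++ v ∷ []) s)) (oneTo (suc (maxW w))))
    ≡⟨ sum-map-cong (All.universal (λ v → trans (count-alive-extensions K (w ++ v ∷ []) s)
                                                (cong (λ σ → survivors K σ s) (foldl-∷ʳ (step K) start v w))) (oneTo (suc (maxW w)))) ⟩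
  sum (map (λ v → survivors K (step K (run K start w) v) s) (oneTo (suc (maxW w))))
    ≡⟨ cong (λ m → sum (map (λ v → survivors K (step K (run K start w) v) s) (oneTo (suc m))))
            (top≡maxW (Tracks-run-start K w)) ⟨
  survivors K (run K start w) (suc s)
    ∎
  where
  open ≡-Reasoning
  P : List ℕ → Bool
  P π = alive (run K start π)

record _≈_ (σ τ : State) : Set where
  field
    top-≡ : top σ ≡ top τ
    forbidden-≡ : ∀ x → forbidden σ x ≡ forbidden τ x
    alive-≡ : alive σ ≡ alive τ
open _≈_

≈-trans : ∀ {σ τ υ} → σ ≈ τ → τ ≈ υ → σ ≈ υ
≈-trans p q = record
  { top-≡ = trans (top-≡ p) (top-≡ q)
  ; forbidden-≡ = λ x → trans (forbidden-≡ p x) (forbidden-≡ q x)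
  ; alive-≡ = trans (alive-≡ p) (alive-≡ q)
  }

step-cong : ∀ K {σ τ} v → σ ≈ τ → step K σ v ≈ step K τ v
step-cong K {state _ _ _} {state _ _ _} v p = record
  { top-≡ = cong (_⊔ v) (top-≡ p)
  ; forbidden-≡ = λ x → cong₂ (λ b m → b ∨ ((v <ᵇ x) ∧ (x + K ≤ᵇ m))) (forbidden-≡ p x) (top-≡ p)
  ; alive-≡ = cong₂ (λ a b → a ∧ not b) (alive-≡ p) (forbidden-≡ p v)
  }

survivors-cong : ∀ K {σ τ} s → σ ≈ τ → survivors K σ s ≡ survivors K τ s
survivors-cong K zero p = cong fromBool (alive-≡ p)
survivors-cong K {σ} {τ} (suc s) p = trans
  (cong (λ m → sum (map (λ v → survivors K (step K σ v) s) (oneTo (suc m)))) (top-≡ p))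
  (sum-map-cong (All.universal (λ v → survivors-cong K s (step-cong K v p)) (oneTo (suc (top τ)))))

survivors-dead : ∀ K σ s → alive σ ≡ false → survivors K σ s ≡ 0
survivors-dead K σ zero dead = cong fromBool dead
survivors-dead K (state m f o) (suc s) refl =
  sum-map-zero (All.universal (λ v → survivors-dead K (step K (state m f false) v) s refl) (oneTo (suc m)))

fresh : ℕ → State
fresh ℓ = state ℓ (λ _ → false) true

step-fresh : ∀ {K ℓ v} → ℓ ≤ v + K → step K (fresh ℓ) v ≈ fresh (ℓ ⊔ v)
step-fresh {K} {ℓ} {v} ℓ≤v+K = record
  { top-≡ = refl
  ; forbidden-≡ = λ x → ≡false-if (<ᵇ-reflects-< v x ×-reflects ≤ᵇ-reflects-≤ (x + K) ℓ)
                          (λ (v<x , x+K≤ℓ) → <⇒≱ (+-monoˡ-< K v<x) (≤-trans x+K≤ℓ ℓ≤v+K))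
  ; alive-≡ = refl
  }

fresh-cong : ∀ {ℓ ℓ′} → ℓ ≡ ℓ′ → fresh ℓ ≈ fresh ℓ′
fresh-cong refl = record { top-≡ = refl ; forbidden-≡ = λ _ → refl ; alive-≡ = refl }

run-oneTo : ∀ K ℓ → run K start (oneTo ℓ) ≈ fresh ℓ
run-oneTo K zero = fresh-cong refl
run-oneTo K (suc ℓ) =
  subst (_≈ fresh (suc ℓ)) (sym (trans (cong (run K start) (oneTo-∷ʳ ℓ)) (foldl-∷ʳ (step K) start (suc ℓ) (oneTo ℓ))))
    (≈-trans (step-cong K (suc ℓ) (run-oneTo K ℓ))
      (≈-trans (step-fresh (≤-trans (n≤1+n ℓ) (m≤m+n (suc ℓ) K))) (fresh-cong (m≤n⇒m⊔n≡n (n≤1+n ℓ)))))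

<ᵇ-+ʳ : ∀ a b d → (a + d <ᵇ b + d) ≡ (a <ᵇ b)
<ᵇ-+ʳ a b d = ≡-if-⇔ (<ᵇ-reflects-< (a + d) (b + d)) (<ᵇ-reflects-< a b) (+-cancelʳ-< d a b) (+-monoˡ-< d)

≤ᵇ-+ʳ : ∀ a b d → (a + d ≤ᵇ b + d) ≡ (a ≤ᵇ b)
≤ᵇ-+ʳ a b d = ≡-if-⇔ (≤ᵇ-reflects-≤ (a + d) (b + d)) (≤ᵇ-reflects-≤ a b) (+-cancelʳ-≤ d a b) (+-monoˡ-≤ d)

-- σ₁ is σ₂ with d extra letters c + 1, …, c + d, all forbidden in σ₁, inserted above c:
-- a letter x > c of σ₂ is the letter x + d of σ₁.
record Simulates (K c d : ℕ) (σ₁ σ₂ : State) : Set where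
  field
    top-+ : top σ₁ ≡ top σ₂ + d
    room : c + K ≤ top σ₂
    same-alive : alive σ₁ ≡ alive σ₂
    gap-forbidden : ∀ x → c < x → x ≤ c + d → forbidden σ₁ x ≡ true
    low-same : ∀ x → x ≤ c → forbidden σ₁ x ≡ forbidden σ₂ x
    high-same : ∀ x → c < x → forbidden σ₁ (x + d) ≡ forbidden σ₂ x
open Simulates

Simulates-step-low : ∀ {K c d σ₁ σ₂} v → v ≤ c → Simulates K c d σ₁ σ₂ → Simulates K c d (step K σ₁ v) (step K σ₂ v)
Simulates-step-low {K} {c} {d} {state m₁ f₁ o₁} {state m₂ f₂ o₂} v v≤c S = record
  { top-+ = trans (m≥n⇒m⊔n≡m v≤m₁) (trans (top-+ S) (cong (_+ d) (sym (m≥n⇒m⊔n≡m v≤m₂))))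
  ; room = ≤-trans (room S) (m≤m⊔n m₂ v)
  ; same-alive = cong₂ (λ a b → a ∧ not b) (same-alive S) (low-same S v v≤c)
  ; gap-forbidden = λ x c<x x≤c+d → cong (_∨ _) (gap-forbidden S x c<x x≤c+d)
  ; low-same = λ x x≤c → cong₂ (λ a b → a ∨ ((v <ᵇ x) ∧ b)) (low-same S x x≤c)
      (trans (≡true-if (≤ᵇ-reflects-≤ (x + K) m₁) (≤-trans (x+K≤m₂ x≤c) m₂≤m₁))
             (sym (≡true-if (≤ᵇ-reflects-≤ (x + K) m₂) (x+K≤m₂ x≤c))))
  ; high-same = λ x c<x → cong₂ _∨_ (high-same S x c<x) (cong₂ _∧_
      (trans (≡true-if (<ᵇ-reflects-< v (x + d)) (≤-trans (s≤s v≤c) (≤-trans c<x (m≤m+n x d))))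
             (sym (≡true-if (<ᵇ-reflects-< v x) (≤-<-trans v≤c c<x))))
      (trans (cong₂ _≤ᵇ_ (xy∙z≈xz∙y x d K) (top-+ S)) (≤ᵇ-+ʳ (x + K) m₂ d)))
  }
  where
  m₂≤m₁ : m₂ ≤ m₁
  m₂≤m₁ = subst (m₂ ≤_) (sym (top-+ S)) (m≤m+n m₂ d)
  v≤m₂ : v ≤ m₂
  v≤m₂ = ≤-trans v≤c (≤-trans (m≤m+n c K) (room S))
  v≤m₁ : v ≤ m₁
  v≤m₁ = ≤-trans v≤m₂ m₂≤m₁
  x+K≤m₂ : ∀ {x} → x ≤ c → x + K ≤ m₂
  x+K≤m₂ x≤c = ≤-trans (+-monoˡ-≤ K x≤c) (room S)

Simulates-step-high : ∀ {K c d σ₁ σ₂} w → c < w → Simulates K c d σ₁ σ₂ →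
                      Simulates K c d (step K σ₁ (w + d)) (step K σ₂ w)
Simulates-step-high {K} {c} {d} {state m₁ f₁ o₁} {state m₂ f₂ o₂} w c<w S = record
  { top-+ = trans (cong (_⊔ (w + d)) (top-+ S)) (sym (+-distribʳ-⊔ d m₂ w))
  ; room = ≤-trans (room S) (m≤m⊔n m₂ w)
  ; same-alive = cong₂ (λ a b → a ∧ not b) (same-alive S) (high-same S w c<w)
  ; gap-forbidden = λ x c<x x≤c+d → cong (_∨ _) (gap-forbidden S x c<x x≤c+d)
  ; low-same = λ x x≤c → cong₂ _∨_ (low-same S x x≤c) (trans
      (cong (_∧ (x + K ≤ᵇ m₁)) (≡false-if (<ᵇ-reflects-< (w + d) x)
        (λ w+d<x → <⇒≱ (≤-<-trans x≤c c<w) (≤-trans (m≤m+n w d) (<⇒≤ w+d<x)))))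
      (sym (cong (_∧ (x + K ≤ᵇ m₂)) (≡false-if (<ᵇ-reflects-< w x) (λ w<x → <⇒≱ (≤-<-trans x≤c c<w) (<⇒≤ w<x))))))
  ; high-same = λ x c<x → cong₂ _∨_ (high-same S x c<x)
      (cong₂ _∧_ (<ᵇ-+ʳ w x d) (trans (cong₂ _≤ᵇ_ (xy∙z≈xz∙y x d K) (top-+ S)) (≤ᵇ-+ʳ (x + K) m₂ d)))
  }

survivors-simulated : ∀ K c d s {σ₁ σ₂} → Simulates K c d σ₁ σ₂ → survivors K σ₁ s ≡ survivors K σ₂ s
survivors-simulated K c d zero S = cong fromBool (same-alive S)
survivors-simulated K c d (suc s) {σ₁@(state m₁ f₁ o₁)} {σ₂@(state m₂ f₂ o₂)} S = begin
  sum (map g₁ (oneTo (suc m₁)))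
    ≡⟨ cong (λ n → sum (map g₁ (oneTo n))) 1+m₁≡ ⟩
  sum (map g₁ (oneTo (c + (d + e))))
    ≡⟨ cong (λ L → sum (map g₁ L)) (trans (oneTo-+ c (d + e)) (cong (interval 1 c ++_) (interval-++ (1 + c) d e))) ⟩
  sum (map g₁ (interval 1 c ++ interval (1 + c) d ++ interval (1 + c + d) e))
    ≡⟨ sum-map-++ g₁ (interval 1 c) _ ⟩
  sum (map g₁ (interval 1 c)) + sum (map g₁ (interval (1 + c) d ++ interval (1 + c + d) e))
    ≡⟨ cong (sum (map g₁ (interval 1 c)) +_) (sum-map-++ g₁ (interval (1 + c) d) _) ⟩
  sum (map g₁ (interval 1 c)) + (sum (map g₁ (interval (1 + c) d)) + sum (map g₁ (interval (1 + c + d) e)))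
    ≡⟨ cong₂ _+_ low (cong₂ _+_ gap high) ⟩
  sum (map g₂ (interval 1 c)) + sum (map g₂ (interval (1 + c) e))
    ≡⟨ sum-map-++ g₂ (interval 1 c) _ ⟨
  sum (map g₂ (interval 1 c ++ interval (1 + c) e))
    ≡⟨ cong (λ L → sum (map g₂ L)) (trans (sym (oneTo-+ c e)) (cong oneTo c+e≡)) ⟩
  sum (map g₂ (oneTo (suc m₂)))
    ∎
  where
  open ≡-Reasoning
  g₁ g₂ : ℕ → ℕ
  g₁ v = survivors K (step K σ₁ v) s
  g₂ v = survivors K (step K σ₂ v) s
  e = suc m₂ ∸ c
  c+e≡ : c + e ≡ suc m₂
  c+e≡ = m+[n∸m]≡n (≤-trans (m≤m+n c K) (≤-trans (room S) (n≤1+n m₂)))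
  1+m₁≡ : suc m₁ ≡ c + (d + e)
  1+m₁≡ = begin
    suc m₁          ≡⟨ cong suc (top-+ S) ⟩
    suc m₂ + d      ≡⟨ cong (_+ d) c+e≡ ⟨
    c + e + d       ≡⟨ xy∙z≈x∙zy c e d ⟩
    c + (d + e)     ∎
  low : sum (map g₁ (interval 1 c)) ≡ sum (map g₂ (interval 1 c))
  low = sum-map-cong (All-interval 1 c (λ v _ v<1+c →
          survivors-simulated K c d s (Simulates-step-low v (≤-pred v<1+c) S)))
  gap : sum (map g₁ (interval (1 + c) d)) ≡ 0
  gap = sum-map-zero (All-interval (1 + c) d (λ v c<v v<1+c+d →
          survivors-dead K (step K σ₁ v) s (trans (cong (λ b → o₁ ∧ not b) (gap-forbidden S v c<v (≤-pred v<1+c+d))) (∧-zeroʳ o₁))))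
  high : sum (map g₁ (interval (1 + c + d) e)) ≡ sum (map g₂ (interval (1 + c) e))
  high = begin
    sum (map g₁ (interval (1 + c + d) e))         ≡⟨ cong (λ L → sum (map g₁ L)) (map-+-interval d (1 + c) e) ⟨
    sum (map g₁ (map (_+ d) (interval (1 + c) e))) ≡⟨ cong sum (map-∘ (interval (1 + c) e)) ⟨
    sum (map (λ w → g₁ (w + d)) (interval (1 + c) e)) ≡⟨ sum-map-cong (All-interval (1 + c) e (λ w c<w _ →
                                                         survivors-simulated K c d s (Simulates-step-high w c<w S))) ⟩
    sum (map g₂ (interval (1 + c) e))             ∎

-- Coefficients of F and G

take-length-++ : ∀ (u t : List ℕ) → take (length u) (u ++ t) ≡ u
take-length-++ [] t = refl
take-length-++ (x ∷ u) t = cong (x ∷_) (take-length-++ u t)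

drop-length-++ : ∀ (u t : List ℕ) → drop (length u) (u ++ t) ≡ t
drop-length-++ [] t = refl
drop-length-++ (x ∷ u) t = drop-length-++ u t

increasing-++ : ∀ ℓ u t → length u ≡ ℓ → increasing ℓ (u ++ t) ≡ (u =ʷ oneTo ℓ) ∧ nextOK ℓ t
increasing-++ .(length u) u t refl
  rewrite ≡true-if (≤ᵇ-reflects-≤ (length u) (length (u ++ t))) (subst (length u ≤_) (sym (length-++ u)) (m≤m+n _ _))
        | take-length-++ u t | drop-length-++ u t = refl

sum-map-concatMap : ∀ (X : List ℕ → ℕ) (g : List ℕ → List (List ℕ)) xs →
                    sum (map X (concatMap g xs)) ≡ sum (map (λ x → sum (map X (g x))) xs)
sum-map-concatMap X g [] = refl
sum-map-concatMap X g (x ∷ xs) =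
  trans (sum-map-++ X (g x) (concatMap g xs)) (cong (sum (map X (g x)) +_) (sum-map-concatMap X g xs))

length-∷ʳ : ∀ (u : List ℕ) v {ℓ} → length u ≡ ℓ → length (u ++ v ∷ []) ≡ suc ℓ
length-∷ʳ u v |u|≡ℓ = trans (length-++ u) (trans (+-comm (length u) 1) (cong suc |u|≡ℓ))

sum-extensions[]≡oneTo : ∀ ℓ (X : List ℕ → ℕ) → (∀ u → length u ≡ ℓ → u ≢ oneTo ℓ → X u ≡ 0) →
                         sum (map X (extensions [] ℓ)) ≡ X (oneTo ℓ)
sum-extensions[]≡oneTo zero X _ = +-identityʳ (X [])
sum-extensions[]≡oneTo (suc ℓ) X X≡0 = begin
  sum (map X (concatMap children (extensions [] ℓ)))
    ≡⟨ sum-map-concatMap X children (extensions [] ℓ) ⟩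
  sum (map (λ u → sum (map X (children u))) (extensions [] ℓ))
    ≡⟨ sum-extensions[]≡oneTo ℓ (λ u → sum (map X (children u))) children≡0 ⟩
  sum (map X (children (oneTo ℓ)))
    ≡⟨ cong (λ m → sum (map X (map (λ v → oneTo ℓ ++ v ∷ []) (oneTo (suc m))))) (maxW-oneTo ℓ) ⟩
  sum (map X (map (λ v → oneTo ℓ ++ v ∷ []) (oneTo (suc ℓ))))
    ≡⟨ cong sum (map-∘ (oneTo (suc ℓ))) ⟨
  sum (map Y (oneTo (suc ℓ)))
    ≡⟨ cong (λ L → sum (map Y L)) (oneTo-∷ʳ ℓ) ⟩
  sum (map Y (oneTo ℓ ++ suc ℓ ∷ []))
    ≡⟨ sum-map-++ Y (oneTo ℓ) (suc ℓ ∷ []) ⟩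
  sum (map Y (oneTo ℓ)) + (Y (suc ℓ) + 0)
    ≡⟨ cong₂ _+_ (sum-map-zero (All.tabulate repeat≡0)) (+-identityʳ (Y (suc ℓ))) ⟩
  Y (suc ℓ)
    ≡⟨ cong X (oneTo-∷ʳ ℓ) ⟨
  X (oneTo (suc ℓ))
    ∎
  where
  open ≡-Reasoning
  Y : ℕ → ℕ
  Y v = X (oneTo ℓ ++ v ∷ [])
  children≡0 : ∀ u → length u ≡ ℓ → u ≢ oneTo ℓ → sum (map X (children u)) ≡ 0
  children≡0 u |u|≡ℓ u≢ = sum-map-zero (All.tabulate λ {π} π∈ →
    let v , _ , _ , π≡ = ∈-children⁻ u π∈ in
    subst (λ π′ → X π′ ≡ 0) (sym π≡) (X≡0 (u ++ v ∷ []) (length-∷ʳ u v |u|≡ℓ)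
      (λ e → u≢ (proj₁ (∷ʳ-injective u (oneTo ℓ) (trans e (oneTo-∷ʳ ℓ)))))))
  repeat≡0 : ∀ {v} → v ∈ oneTo ℓ → Y v ≡ 0
  repeat≡0 {v} v∈ = X≡0 (oneTo ℓ ++ v ∷ []) (length-∷ʳ (oneTo ℓ) v (length-oneTo ℓ))
    (λ e → <-irrefl (proj₂ (∷ʳ-injective (oneTo ℓ) (oneTo ℓ) (trans e (oneTo-∷ʳ ℓ)))) (s≤s (proj₂ (∈-oneTo⁻ v∈))))

increasing-oneTo-++ : ∀ ℓ t → increasing ℓ (oneTo ℓ ++ t) ≡ nextOK ℓ t
increasing-oneTo-++ ℓ t
  rewrite increasing-++ ℓ (oneTo ℓ) t (length-oneTo ℓ) | ≡true-if (=ʷ-reflects-≡ (oneTo ℓ) (oneTo ℓ)) refl = refl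

increasing-short : ∀ ℓ π → length π < ℓ → increasing ℓ π ≡ false
increasing-short ℓ π |π|<ℓ rewrite ≡false-if (≤ᵇ-reflects-≤ ℓ (length π)) (<⇒≱ |π|<ℓ) = refl

F-below : ∀ k ℓ n → n < ℓ → F k ℓ n ≡ 0
F-below k ℓ n n<ℓ rewrite partitions≡extensions n = count-zero _ (extensions [] n) λ {π} π∈ →
  let t , π≡t , |t|≡n = ∈-extensions⁻ [] n π∈
  in cong (_∧ avoids π (pat k)) (increasing-short ℓ π (subst (_< ℓ) (sym (trans (cong length π≡t) |t|≡n)) n<ℓ))

module _ (K ℓ : ℕ) where

  counted : List ℕ → Bool
  counted π = increasing ℓ π ∧ alive (run K start π)

  F-count : ∀ n → F (2 + K) ℓ n ≡ count counted (extensions [] n)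
  F-count n = trans (cong (count _) (partitions≡extensions n)) (count-cong _ counted (extensions [] n) λ π∈ →
    cong (increasing ℓ _ ∧_) (avoids≡alive K _ (extensions[]⇒RestrictedGrowth n π∈)))

  F-from-oneTo : ∀ s → F (2 + K) ℓ (ℓ + s) ≡ count counted (extensions (oneTo ℓ) s)
  F-from-oneTo s = begin
    F (2 + K) ℓ (ℓ + s)                                                  ≡⟨ F-count (ℓ + s) ⟩
    count counted (extensions [] (ℓ + s))                                     ≡⟨ cong (count counted) (extensions-+ [] ℓ s) ⟩
    count counted (concatMap (λ u → extensions u s) (extensions [] ℓ))       ≡⟨ count-concatMap counted (λ u → extensions u s) (extensions [] ℓ) ⟩
    sum (map (λ u → count counted (extensions u s)) (extensions [] ℓ))       ≡⟨ sum-extensions[]≡oneTo ℓ _ others≡0 ⟩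
    count counted (extensions (oneTo ℓ) s)                                    ∎
    where
    open ≡-Reasoning
    others≡0 : ∀ u → length u ≡ ℓ → u ≢ oneTo ℓ → count counted (extensions u s) ≡ 0
    others≡0 u |u|≡ℓ u≢ = count-zero counted (extensions u s) λ π∈ →
      let t , π≡ , _ = ∈-extensions⁻ u s π∈ in
      subst (λ π → counted π ≡ false) (sym π≡)
        (cong (_∧ _) (trans (increasing-++ ℓ u t |u|≡ℓ) (cong (_∧ nextOK ℓ t) (≡false-if (=ʷ-reflects-≡ u (oneTo ℓ)) u≢))))

  F-diagonal : F (2 + K) ℓ (ℓ + 0) ≡ 1
  F-diagonal rewrite F-from-oneTo 0 with counted (oneTo ℓ) | counted-oneTo
    where
    counted-oneTo : counted (oneTo ℓ) ≡ true
    counted-oneTo = cong₂ _∧_ (trans (cong (increasing ℓ) (sym (++-identityʳ (oneTo ℓ)))) (increasing-oneTo-++ ℓ []))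
                         (alive-≡ (run-oneTo K ℓ))
  ... | true | refl = refl

  counted-after : ∀ s v {π} → π ∈ extensions (oneTo ℓ ++ v ∷ []) s → counted π ≡ not (v ≡ᵇ suc ℓ) ∧ alive (run K start π)
  counted-after s v π∈ with ∈-extensions⁻ (oneTo ℓ ++ v ∷ []) s π∈
  ... | t , refl , _ = cong (_∧ alive (run K start ((oneTo ℓ ++ v ∷ []) ++ t)))
                            (trans (cong (increasing ℓ) (++-assoc (oneTo ℓ) (v ∷ []) t)) (increasing-oneTo-++ ℓ (v ∷ t)))

  count-after-new : ∀ s → count counted (extensions (oneTo ℓ ++ suc ℓ ∷ []) s) ≡ 0
  count-after-new s = count-zero counted _ λ {π} π∈ → trans (counted-after s (suc ℓ) π∈)
    (cong (λ b → not b ∧ alive (run K start π)) (≡true-if (≡ᵇ-reflects-≡ (suc ℓ) (suc ℓ)) refl))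

  count-after-repeat : ∀ s {v} → v ≤ ℓ → count counted (extensions (oneTo ℓ ++ v ∷ []) s) ≡ survivors K (step K (fresh ℓ) v) s
  count-after-repeat s {v} v≤ℓ = begin
    count counted (extensions (oneTo ℓ ++ v ∷ []) s)
      ≡⟨ count-cong counted _ _ (λ {π} π∈ → trans (counted-after s v π∈) (cong (λ b → not b ∧ alive (run K start π))
           (≡false-if (≡ᵇ-reflects-≡ v (suc ℓ)) (λ v≡ → <-irrefl v≡ (s≤s v≤ℓ))))) ⟩
    count (λ π → alive (run K start π)) (extensions (oneTo ℓ ++ v ∷ []) s)
      ≡⟨ count-alive-extensions K (oneTo ℓ ++ v ∷ []) s ⟩
    survivors K (run K start (oneTo ℓ ++ v ∷ [])) s
      ≡⟨ cong (λ σ → survivors K σ s) (foldl-∷ʳ (step K) start v (oneTo ℓ)) ⟩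
    survivors K (step K (run K start (oneTo ℓ)) v) s
      ≡⟨ survivors-cong K s (step-cong K v (run-oneTo K ℓ)) ⟩
    survivors K (step K (fresh ℓ) v) s
      ∎
    where open ≡-Reasoning

  F-next : ∀ s → F (2 + K) ℓ (ℓ + suc s) ≡ sum (map (λ v → survivors K (step K (fresh ℓ) v) s) (oneTo ℓ))
  F-next s = begin
    F (2 + K) ℓ (ℓ + suc s)                          ≡⟨ F-from-oneTo (suc s) ⟩
    count counted (extensions (oneTo ℓ) (suc s))     ≡⟨ count-extensions-suc counted (oneTo ℓ) s ⟩
    sum (map Y (oneTo (suc (maxW (oneTo ℓ)))))       ≡⟨ cong (λ m → sum (map Y (oneTo (suc m)))) (maxW-oneTo ℓ) ⟩
    sum (map Y (oneTo (suc ℓ)))                      ≡⟨ cong (λ L → sum (map Y L)) (oneTo-∷ʳ ℓ) ⟩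
    sum (map Y (oneTo ℓ ++ suc ℓ ∷ []))              ≡⟨ sum-map-++ Y (oneTo ℓ) (suc ℓ ∷ []) ⟩
    sum (map Y (oneTo ℓ)) + (Y (suc ℓ) + 0)
      ≡⟨ cong₂ _+_ (sum-map-cong (All.tabulate λ v∈ → count-after-repeat s (proj₂ (∈-oneTo⁻ v∈))))
                   (trans (+-identityʳ (Y (suc ℓ))) (count-after-new s)) ⟩
    sum (map (λ v → survivors K (step K (fresh ℓ) v) s) (oneTo ℓ)) + 0
      ≡⟨ +-identityʳ _ ⟩
    sum (map (λ v → survivors K (step K (fresh ℓ) v) s) (oneTo ℓ))
      ∎
    where
    open ≡-Reasoning
    Y : ℕ → ℕ
    Y v = count counted (extensions (oneTo ℓ ++ v ∷ []) s)

survivors-fresh-suc : ∀ K ℓ s → survivors K (fresh ℓ) (suc s)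
                    ≡ sum (map (λ v → survivors K (step K (fresh ℓ) v) s) (oneTo ℓ)) + survivors K (fresh (suc ℓ)) s
survivors-fresh-suc K ℓ s = begin
  sum (map g (oneTo (suc ℓ)))                 ≡⟨ cong (λ L → sum (map g L)) (oneTo-∷ʳ ℓ) ⟩
  sum (map g (oneTo ℓ ++ suc ℓ ∷ []))         ≡⟨ sum-map-++ g (oneTo ℓ) (suc ℓ ∷ []) ⟩
  sum (map g (oneTo ℓ)) + (g (suc ℓ) + 0)     ≡⟨ cong (sum (map g (oneTo ℓ)) +_) (+-identityʳ (g (suc ℓ))) ⟩
  sum (map g (oneTo ℓ)) + g (suc ℓ)           ≡⟨ cong (sum (map g (oneTo ℓ)) +_) (survivors-cong K s new-letter) ⟩
  sum (map g (oneTo ℓ)) + survivors K (fresh (suc ℓ)) s ∎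
  where
  open ≡-Reasoning
  g : ℕ → ℕ
  g v = survivors K (step K (fresh ℓ) v) s
  new-letter : step K (fresh ℓ) (suc ℓ) ≈ fresh (suc ℓ)
  new-letter = ≈-trans (step-fresh (≤-trans (n≤1+n ℓ) (m≤m+n (suc ℓ) K))) (fresh-cong (m≤n⇒m⊔n≡n (n≤1+n ℓ)))

G-as-sum : ∀ k ℓ s → G k ℓ (ℓ + s) ≡ sum (map (λ t → F k (ℓ + t) (ℓ + s)) (interval 0 (suc s)))
G-as-sum k ℓ s = cong (λ L → sum (map (λ t → F k (ℓ + t) (ℓ + s)) L))
  (trans (cong upTo (trans (cong (_∸ ℓ) (sym (+-suc ℓ s))) (m+n∸m≡n ℓ (suc s)))) (upTo≡interval (suc s)))

G-below : ∀ k ℓ m → m < ℓ → G k ℓ m ≡ 0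
G-below k ℓ m m<ℓ rewrite m≤n⇒m∸n≡0 m<ℓ = refl

G≡survivors : ∀ K ℓ s → G (2 + K) ℓ (ℓ + s) ≡ survivors K (fresh ℓ) s
G≡survivors K ℓ zero = begin
  G (2 + K) ℓ (ℓ + 0)              ≡⟨ G-as-sum (2 + K) ℓ 0 ⟩
  F (2 + K) (ℓ + 0) (ℓ + 0) + 0    ≡⟨ +-identityʳ _ ⟩
  F (2 + K) (ℓ + 0) (ℓ + 0)        ≡⟨ cong (λ ℓ′ → F (2 + K) ℓ′ (ℓ + 0)) (+-identityʳ ℓ) ⟩
  F (2 + K) ℓ (ℓ + 0)              ≡⟨ F-diagonal K ℓ ⟩
  1                                ∎
  where open ≡-Reasoning
G≡survivors K ℓ (suc s) = begin
  G (2 + K) ℓ (ℓ + suc s)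
    ≡⟨ G-as-sum (2 + K) ℓ (suc s) ⟩
  F (2 + K) (ℓ + 0) (ℓ + suc s) + sum (map (λ t → F (2 + K) (ℓ + t) (ℓ + suc s)) (interval 1 (suc s)))
    ≡⟨ cong₂ _+_ (trans (cong (λ ℓ′ → F (2 + K) ℓ′ (ℓ + suc s)) (+-identityʳ ℓ)) (F-next K ℓ s)) longer ⟩
  sum (map (λ v → survivors K (step K (fresh ℓ) v) s) (oneTo ℓ)) + survivors K (fresh (suc ℓ)) s
    ≡⟨ survivors-fresh-suc K ℓ s ⟨
  survivors K (fresh ℓ) (suc s)
    ∎
  where
  open ≡-Reasoning
  longer : sum (map (λ t → F (2 + K) (ℓ + t) (ℓ + suc s)) (interval 1 (suc s))) ≡ survivors K (fresh (suc ℓ)) s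
  longer = begin
    sum (map (λ t → F (2 + K) (ℓ + t) (ℓ + suc s)) (interval 1 (suc s)))
      ≡⟨ cong (λ L → sum (map (λ t → F (2 + K) (ℓ + t) (ℓ + suc s)) L)) (map-suc-interval 0 (suc s)) ⟨
    sum (map (λ t → F (2 + K) (ℓ + t) (ℓ + suc s)) (map suc (interval 0 (suc s))))
      ≡⟨ cong sum (map-∘ (interval 0 (suc s))) ⟨
    sum (map (λ t → F (2 + K) (ℓ + suc t) (ℓ + suc s)) (interval 0 (suc s)))
      ≡⟨ cong sum (map-cong (λ t → cong₂ (F (2 + K)) (+-suc ℓ t) (+-suc ℓ s)) (interval 0 (suc s))) ⟩
    sum (map (λ t → F (2 + K) (suc ℓ + t) (suc ℓ + s)) (interval 0 (suc s)))
      ≡⟨ G-as-sum (2 + K) (suc ℓ) s ⟨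
    G (2 + K) (suc ℓ) (suc ℓ + s)
      ≡⟨ G≡survivors K (suc ℓ) s ⟩
    survivors K (fresh (suc ℓ)) s
      ∎

Simulates-repeat : ∀ K c d → Simulates K c d (step K (fresh (c + K + d)) c) (fresh (c + K))
Simulates-repeat K c d = record
  { top-+ = m≥n⇒m⊔n≡m (≤-trans (m≤m+n c K) (m≤m+n (c + K) d))
  ; room = ≤-refl
  ; same-alive = refl
  ; gap-forbidden = λ x c<x x≤c+d → ≡true-if (<ᵇ-reflects-< c x ×-reflects ≤ᵇ-reflects-≤ (x + K) (c + K + d))
      (c<x , ≤-trans (+-monoˡ-≤ K x≤c+d) (≤-reflexive (xy∙z≈xz∙y c d K)))
  ; low-same = λ x x≤c → cong (_∧ (x + K ≤ᵇ c + K + d)) (≡false-if (<ᵇ-reflects-< c x) (≤⇒≯ x≤c))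
  ; high-same = λ x c<x → ≡false-if (<ᵇ-reflects-< c (x + d) ×-reflects ≤ᵇ-reflects-≤ (x + d + K) (c + K + d))
      (λ (_ , x+d+K≤) → <⇒≱ (subst (_< x + d + K) (sym (xy∙z≈xz∙y c K d)) (+-monoˡ-< K (+-monoˡ-< d c<x))) x+d+K≤)
  }

survivors-repeat : ∀ K {i j} s → i < j → survivors K (step K (fresh (suc K + j)) (suc i)) s ≡ survivors K (fresh (suc K + i)) s
survivors-repeat K {i} {j} s i<j = begin
  survivors K (step K (fresh (suc K + j)) (suc i)) s
    ≡⟨ survivors-cong K s (step-cong K (suc i) (fresh-cong ℓ≡)) ⟩
  survivors K (step K (fresh (suc i + K + (j ∸ i))) (suc i)) s
    ≡⟨ survivors-simulated K (suc i) (j ∸ i) s (Simulates-repeat K (suc i) (j ∸ i)) ⟩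
  survivors K (fresh (suc i + K)) s
    ≡⟨ survivors-cong K s (fresh-cong (cong suc (+-comm i K))) ⟩
  survivors K (fresh (suc K + i)) s
    ∎
  where
  open ≡-Reasoning
  ℓ≡ : suc K + j ≡ suc i + K + (j ∸ i)
  ℓ≡ = cong suc (begin
    K + j             ≡⟨ cong (K +_) (m+[n∸m]≡n (<⇒≤ i<j)) ⟨
    K + (i + (j ∸ i)) ≡⟨ +-assoc K i (j ∸ i) ⟨
    K + i + (j ∸ i)   ≡⟨ cong (_+ (j ∸ i)) (+-comm K i) ⟩
    i + K + (j ∸ i)   ∎)

mono-≢ : ∀ a n → a ≢ n → mono a n ≡ 0
mono-≢ a n a≢n rewrite ≡false-if (≡ᵇ-reflects-≡ a n) a≢n = refl

mono-diagonal : ∀ a → mono a a ≡ 1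
mono-diagonal a rewrite ≡true-if (≡ᵇ-reflects-≡ a a) refl = refl

shift-≤ : ∀ a (g : FPS) {n} → a ≤ n → shift a g n ≡ g (n ∸ a)
shift-≤ a g {n} a≤n rewrite ≡true-if (≤ᵇ-reflects-≤ a n) a≤n = refl

shift-vanishes : ∀ a (g : FPS) n → (a ≤ n → g (n ∸ a) ≡ 0) → shift a g n ≡ 0
shift-vanishes a g n g≡0 with a ≤ᵇ n | ≤ᵇ-reflects-≤ a n
... | false | _ = refl
... | true | ofʸ a≤n = g≡0 a≤n

-- Here k = K + 2 and ℓ = k − 1 + j; Tail and Repeat are the last two summands of the identity.
module _ (K j : ℕ) where

  tail-shift : ℕ → ℕ
  tail-shift i = j + 1 ∸ i

  Tail : FPS
  Tail = sumS j (λ i → shift (tail-shift i) (G (2 + K) (suc K + i)))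

  Repeat : FPS
  Repeat = scale (suc K) (shift 1 (G (2 + K) (suc K + j)))

  tail-shift-+ : ∀ {i} → i < j → suc K + i + tail-shift i ≡ suc K + j + 1
  tail-shift-+ {i} i<j = begin
    suc K + i + (j + 1 ∸ i)     ≡⟨ +-assoc (suc K) i _ ⟩
    suc K + (i + (j + 1 ∸ i))   ≡⟨ cong (suc K +_) (m+[n∸m]≡n (≤-trans (<⇒≤ i<j) (m≤m+n j 1))) ⟩
    suc K + (j + 1)             ≡⟨ +-assoc (suc K) j 1 ⟨
    suc K + j + 1               ∎
    where open ≡-Reasoning

  Tail-vanishes : ∀ n → n ≤ suc K + j → Tail n ≡ 0
  Tail-vanishes n n≤ℓ = trans (cong (λ L → sum (map (λ i → shift (tail-shift i) (G (2 + K) (suc K + i)) n) L)) (upTo≡interval j))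
    (sum-map-zero (All-interval 0 j λ i _ i<j → shift-vanishes (tail-shift i) (G (2 + K) (suc K + i)) n λ a≤n →
      G-below (2 + K) (suc K + i) (n ∸ tail-shift i) (+-cancelʳ-< (tail-shift i) (n ∸ tail-shift i) (suc K + i) (begin-strict
        n ∸ tail-shift i + tail-shift i   ≡⟨ m∸n+n≡m a≤n ⟩
        n                                 ≤⟨ n≤ℓ ⟩
        suc K + j                         <⟨ m<m+n (suc K + j) (s≤s z≤n) ⟩
        suc K + j + 1                     ≡⟨ tail-shift-+ i<j ⟨
        suc K + i + tail-shift i          ∎))))
    where open ≤-Reasoning

  Repeat-vanishes : ∀ n → n ≤ suc K + j → Repeat n ≡ 0
  Repeat-vanishes n n≤ℓ = trans (cong (suc K *_) (shift-vanishes 1 (G (2 + K) (suc K + j)) n λ 1≤n →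
    G-below (2 + K) (suc K + j) (n ∸ 1) (<-≤-trans (∸-monoʳ-< {n} {1} {0} (s≤s z≤n) 1≤n) n≤ℓ))) (*-zeroʳ (suc K))

  Tail-above : ∀ s → Tail (suc K + j + suc s) ≡ sum (map (λ i → survivors K (fresh (suc K + i)) s) (upTo j))
  Tail-above s = cong sum (map-cong-local (All.tabulate λ {i} i∈ → term (∈-upTo⁻ i∈)))
    where
    n = suc K + j + suc s
    term : ∀ {i} → i < j → shift (tail-shift i) (G (2 + K) (suc K + i)) n ≡ survivors K (fresh (suc K + i)) s
    term {i} i<j = begin
      shift (tail-shift i) (G (2 + K) (suc K + i)) n
        ≡⟨ shift-≤ (tail-shift i) (G (2 + K) (suc K + i))
             (≤-trans (m∸n≤m (j + 1) i) (≤-trans (≤-reflexive (+-comm j 1)) (s≤s (≤-trans (m≤n+m j K) (m≤m+n (K + j) (suc s)))))) ⟩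
      G (2 + K) (suc K + i) (n ∸ tail-shift i)
        ≡⟨ cong (G (2 + K) (suc K + i)) (trans (cong (_∸ tail-shift i) n≡) (m+n∸n≡m (suc K + i + s) (tail-shift i))) ⟩
      G (2 + K) (suc K + i) (suc K + i + s)
        ≡⟨ G≡survivors K (suc K + i) s ⟩
      survivors K (fresh (suc K + i)) s
        ∎
      where
      open ≡-Reasoning
      n≡ : n ≡ suc K + i + s + tail-shift i
      n≡ = begin
        suc K + j + suc s              ≡⟨ +-assoc (suc K + j) 1 s ⟨
        suc K + j + 1 + s              ≡⟨ cong (_+ s) (tail-shift-+ i<j) ⟨
        suc K + i + tail-shift i + s   ≡⟨ xy∙z≈xz∙y (suc K + i) (tail-shift i) s ⟩
        suc K + i + s + tail-shift i   ∎

  Repeat-above : ∀ s → Repeat (suc K + j + suc s) ≡ suc K * survivors K (fresh (suc K + j)) s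
  Repeat-above s = cong (suc K *_) (begin
    shift 1 (G (2 + K) (suc K + j)) (suc K + j + suc s)
      ≡⟨ shift-≤ 1 (G (2 + K) (suc K + j)) (≤-trans (s≤s z≤n) (m≤n+m (suc s) (suc K + j))) ⟩
    G (2 + K) (suc K + j) (suc K + j + suc s ∸ 1)         ≡⟨ cong (λ m → G (2 + K) (suc K + j) (m ∸ 1)) (+-suc (suc K + j) s) ⟩
    G (2 + K) (suc K + j) (suc K + j + s)                 ≡⟨ G≡survivors K (suc K + j) s ⟩
    survivors K (fresh (suc K + j)) s                     ∎)
    where open ≡-Reasoning

  F-above : ∀ s → F (2 + K) (suc K + j) (suc K + j + suc s)
          ≡ sum (map (λ i → survivors K (fresh (suc K + i)) s) (upTo j)) + suc K * survivors K (fresh (suc K + j)) s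
  F-above s = begin
    F (2 + K) ℓ (ℓ + suc s)
      ≡⟨ F-next K ℓ s ⟩
    sum (map g (oneTo ℓ))
      ≡⟨ cong (λ L → sum (map g L)) (trans (cong oneTo (+-comm (suc K) j)) (oneTo-+ j (suc K))) ⟩
    sum (map g (interval 1 j ++ interval (1 + j) (suc K)))
      ≡⟨ sum-map-++ g (interval 1 j) (interval (1 + j) (suc K)) ⟩
    sum (map g (interval 1 j)) + sum (map g (interval (1 + j) (suc K)))
      ≡⟨ cong₂ _+_ repeats non-repeats ⟩
    sum (map (λ i → survivors K (fresh (suc K + i)) s) (upTo j)) + suc K * survivors K (fresh ℓ) s
      ∎
    where
    open ≡-Reasoning
    ℓ = suc K + j
    g : ℕ → ℕ
    g v = survivors K (step K (fresh ℓ) v) s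
    repeats : sum (map g (interval 1 j)) ≡ sum (map (λ i → survivors K (fresh (suc K + i)) s) (upTo j))
    repeats = begin
      sum (map g (interval 1 j))                         ≡⟨ cong (λ L → sum (map g L)) (map-suc-interval 0 j) ⟨
      sum (map g (map suc (interval 0 j)))               ≡⟨ cong sum (map-∘ (interval 0 j)) ⟨
      sum (map (λ i → g (suc i)) (interval 0 j))         ≡⟨ sum-map-cong (All-interval 0 j (λ i _ i<j → survivors-repeat K s i<j)) ⟩
      sum (map (λ i → survivors K (fresh (suc K + i)) s) (interval 0 j))
        ≡⟨ cong (λ L → sum (map (λ i → survivors K (fresh (suc K + i)) s) L)) (upTo≡interval j) ⟨
      sum (map (λ i → survivors K (fresh (suc K + i)) s) (upTo j)) ∎
    non-repeats : sum (map g (interval (1 + j) (suc K))) ≡ suc K * survivors K (fresh ℓ) s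
    non-repeats = trans (sum-map-const (All-interval (1 + j) (suc K) λ v j<v v<1+j+1+K →
        survivors-cong K s (≈-trans (step-fresh (≤-trans (≤-reflexive (cong suc (+-comm K j))) (+-monoˡ-≤ K j<v)))
                                    (fresh-cong (m≥n⇒m⊔n≡m (≤-pred (subst (v <_) (cong suc (+-comm j (suc K))) v<1+j+1+K)))))))
      (cong (_* survivors K (fresh ℓ) s) (length-interval (1 + j) (suc K)))

  F-coefficient : ∀ n → F (2 + K) (suc K + j) n ≡ (mono (suc K + j) ⊕ Tail ⊕ Repeat) n
  F-coefficient n with <-cmp n (suc K + j)
  ... | tri< n<ℓ _ _ = trans (F-below (2 + K) (suc K + j) n n<ℓ) (sym (cong₂ _+_
          (cong₂ _+_ (mono-≢ (suc K + j) n (>⇒≢ n<ℓ)) (Tail-vanishes n (<⇒≤ n<ℓ))) (Repeat-vanishes n (<⇒≤ n<ℓ))))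
  ... | tri≈ _ refl _ = trans (trans (cong (F (2 + K) n) (sym (+-identityʳ n))) (F-diagonal K n)) (sym (cong₂ _+_
          (cong₂ _+_ (mono-diagonal n) (Tail-vanishes n ≤-refl)) (Repeat-vanishes n ≤-refl)))
  ... | tri> _ _ ℓ<n with m≤n⇒∃[o]m+o≡n ℓ<n
  ...   | s , refl = subst (λ m → F (2 + K) (suc K + j) m ≡ (mono (suc K + j) ⊕ Tail ⊕ Repeat) m) (+-suc (suc K + j) s)
          (trans (F-above s) (sym (cong₂ _+_ (cong₂ _+_ (mono-≢ (suc K + j) _ ℓ≢) (Tail-above s)) (Repeat-above s))))
    where
    ℓ≢ : suc K + j ≢ suc K + j + suc s
    ℓ≢ e = <-irrefl e (m<m+n (suc K + j) (s≤s z≤n))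

lemma3 : (k : ℕ) → 2 ≤ k → (j : ℕ) → (n : ℕ) →
    F k (k ∸ 1 + j) n
      ≡ (mono (k ∸ 1 + j)
         ⊕ sumS j (λ i → shift (j + 1 ∸ i) (G k (k ∸ 1 + i)))
         ⊕ scale (k ∸ 1) (shift 1 (G k (k ∸ 1 + j)))) n
lemma3 (suc (suc K)) (s≤s (s≤s z≤n)) j n = F-coefficient K j n
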